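{- Let $s\ge 0$ and $t\ge 1$ be integers, and let $a_1\ge a_2\ge\cdots\ge a_s\ge 3$ be odd integers. Let $\mu_0$ be the partition obtained by sorting the list $[a_1,\dots,a_s,2,2^2,\dots,2^{t-1}]$ in non-increasing order (when $t=1$ the string of powers of $2$ is empty, so $\mu_0$ consists only of the odd parts $a_i$), and let $\mu_0'$ be the partition obtained by sorting $[a_1,\dots,a_s,2^t]$ in non-increasing order. Then for every integer $n\ge |\mu_0|$, $$A(\mu_0)(n)=\tfrac12\, B(\mu_0')(n+2).$$
   Context: For a partition $\mu$, $|\mu|$ denotes the sum of its parts. For partitions $\lambda,\mu$ of $N$, $\chi^{\lambda}(\mu)$ denotes the value of the irreducible character of the symmetric group $S_N$ indexed by $\lambda$ on the conjugacy class of permutations of cycle type $\mu$. For a partition $\nu$ with all parts $\ge 2$ and an integer $N\ge|\nu|$, $\nu 1^{N-|\nu|}$ denotes the partition of $N$ obtained by appending $N-|\nu|$ parts equal to $1$ to $\nu$. Define $$A(\nu)(N)=\sum_{j=0}^{\lfloor N/2\rfloor}\chi^{(N-j,j)}(\nu 1^{N-|\nu|})^2$$ (sum over two-rowed shapes, where $(N,0)$ means the one-row shape $(N)$), and $$B(\nu)(N)=\sum_{j=1}^{N}\chi^{(j,1^{N-j})}(\nu 1^{N-|\nu|})^2$$ (sum over hook shapes $(j,1,\dots,1)$ with $N-j$ ones). -}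

module Defs where

open import Data.Nat as ℕ using (ℕ; zero; suc; _+_; _*_; _∸_; _^_; _≤_; _<_; _≥_; _/_; _≤ᵇ_; _<ᵇ_; _≡ᵇ_)
open import Data.Integer as ℤ using (ℤ; +_)
open import Data.Nat.ListAction using (sum)
open import Data.List using (List; []; _∷_; length; map; replicate; _++_; foldr; upTo; filter; applyUpTo)
open import Data.Bool using (Bool; true; false; if_then_else_; _∧_; _∨_; not)

∣_∣ₚ : List ℕ → ℕ
∣ μ ∣ₚ = sum μ

insertDesc : ℕ → List ℕ → List ℕ
insertDesc x [] = x ∷ []
insertDesc x (y ∷ ys) = if y ≤ᵇ x then x ∷ y ∷ ys else y ∷ insertDesc x ys

sortDesc : List ℕ → List ℕ
sortDesc = foldr insertDesc []

-- Characters of the symmetric group via the Murnaghan–Nakayama rule,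
-- computed on beta-sets (abacus): a partition (λ₁ ≥ … ≥ λₖ) with k parts
-- (zero parts allowed) has beta-set {λᵢ + (k - i) | i = 1..k}.  Removing a
-- border strip of size r corresponds to moving a bead b to the empty
-- position b - r ≥ 0, with sign (-1)^(number of beads strictly between).

betaSet : List ℕ → List ℕ
betaSet []       = []
betaSet (x ∷ xs) = (x + length xs) ∷ betaSet xs

memb : ℕ → List ℕ → Bool
memb x []       = false
memb x (y ∷ ys) = (x ≡ᵇ y) ∨ memb x ys

between : ℕ → ℕ → List ℕ → ℕ
between lo hi []       = 0
between lo hi (c ∷ cs) = (if (lo <ᵇ c) ∧ (c <ᵇ hi) then 1 else 0) + between lo hi cs

replaceBead : ℕ → ℕ → List ℕ → List ℕ
replaceBead b b' []       = []
replaceBead b b' (c ∷ cs) = if c ≡ᵇ b then b' ∷ cs else c ∷ replaceBead b b' cs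

sign : ℕ → ℤ
sign zero    = ℤ.+ 1
sign (suc m) = ℤ.- sign m

sumℤ : List ℤ → ℤ
sumℤ = foldr ℤ._+_ (ℤ.+ 0)

-- all beads packed at the bottom: the beta-set of the empty partition
emptyβ : List ℕ → Bool
emptyβ β = go β
  where
  go : List ℕ → Bool
  go []       = true
  go (c ∷ cs) = (c <ᵇ length β) ∧ go cs

χβ : List ℕ → List ℕ → ℤ
χβ β []      = if emptyβ β then ℤ.+ 1 else ℤ.+ 0
χβ β (r ∷ μ) = sumℤ (map term β)
  where
  term : ℕ → ℤ
  term b = if (r ≤ᵇ b) ∧ not (memb (b ∸ r) β)
             then sign (between (b ∸ r) b β) ℤ.* χβ (replaceBead b (b ∸ r) β) μ
             else ℤ.+ 0

χ : List ℕ → List ℕ → ℤ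
χ lam μ = χβ (betaSet lam) μ

pad : List ℕ → ℕ → List ℕ
pad ν N = ν ++ replicate (N ∸ ∣ ν ∣ₚ) 1

sq : ℤ → ℤ
sq x = x ℤ.* x

A : List ℕ → ℕ → ℤ
A ν N = sumℤ (map (λ j → sq (χ ((N ∸ j) ∷ j ∷ []) (pad ν N))) (upTo (suc (N / 2))))

B : List ℕ → ℕ → ℤ
B ν N = sumℤ (map (λ i → sq (χ (suc i ∷ replicate (N ∸ suc i) 1) (pad ν N))) (upTo N))

-- the list [2, 2², …, 2^(t-1)]  (empty for t ≤ 1)
powers2 : ℕ → List ℕ
powers2 t = applyUpTo (λ i → 2 ^ suc i) (t ∸ 1)

μ₀ : List ℕ → ℕ → List ℕ
μ₀ a t = sortDesc (a ++ powers2 t)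

μ₀' : List ℕ → ℕ → List ℕ
μ₀' a t = sortDesc (a ++ (2 ^ t ∷ []))

{-# OPTIONS --safe #-}
-- Let ν = μ₀ 1^(n - |μ₀|), ν' = μ₀' 1^(n + 2 - |μ₀'|), and F_k the coefficient of x^k in (1 - x) ∏_{r ∈ ν} (1 + x^r).
-- On abaci, the Murnaghan–Nakayama rule gives χ^(n-j,j)(ν) = F_j for 2j ≤ n (two beads), and, with N = n + 2,
-- χ^(i+1,1^(N-1-i))(ν') = [x^(N-1-i)] ∏_{r ∈ ν'} (1 - (-x)^r) / (1 + x) (one bead above a column with one gap).
-- Under x ↦ -x an odd part a gives 1 + x^a, a part 1 gives 1 + x, and (1 - x^(2^t)) / (1 + x) is
-- (1 - x)(1 + x²)⋯(1 + x^(2^(t-1))); so the hook values are F_(N-1-i), and B(μ₀')(n + 2) = ∑_k F_k².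
-- Since ∏ (1 + x^r) is a palindrome of degree n, F_k = -F_(n+1-k), so ∑_k F_k² is twice the sum over 2k ≤ n.
module Submission where

open import Defs
open import Data.Nat using (ℕ; _≥_; _%_; _+_)
open import Data.Integer as ℤ using (ℤ; +_)
open import Data.List using (List)
open import Data.List.Relation.Unary.All using (All)
open import Data.List.Relation.Unary.Linked using (Linked)
open import Relation.Binary.PropositionalEquality using (_≡_)

open import Data.Nat using (zero; suc; _*_; _∸_; _^_; _⊓_; _≤_; _<_; _/_; z≤n; s≤s; _≤ᵇ_; _<ᵇ_; _≡ᵇ_)
import Data.Nat.Properties as ℕₚ
import Data.Nat.DivMod as DivMod
open import Data.Nat.ListAction using (sum)
open import Data.Nat.ListAction.Properties using (sum-++; sum-↭)
open import Data.Integer using (-[1+_]; 0ℤ; 1ℤ; -1ℤ)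
import Data.Integer.Properties as ℤₚ
open import Data.Integer.Solver using (module +-*-Solver)
import Data.Nat.Solver as ℕSolver
open import Data.List using ([]; _∷_; length; map; replicate; _++_; applyUpTo)
open import Data.List.Relation.Binary.Permutation.Propositional as ↭ using (_↭_; ↭-refl; ↭-prep; ↭-swap; ↭-trans)
import Data.List.Relation.Binary.Permutation.Propositional.Properties as ↭ₚ
open import Data.List.Properties using (applyUpTo-∷ʳ; length-replicate; ++-assoc)
open import Data.List.Relation.Unary.All using ([]; _∷_)
open import Data.List.Relation.Unary.Any using (here; there)
open import Data.List.Membership.Propositional using (_∈_; _∉_)
open import Data.List.Relation.Unary.Unique.Propositional using (Unique)
open import Data.List.Relation.Unary.AllPairs using ([]; _∷_)
import Data.List.Relation.Unary.All as All
import Data.List.Relation.Unary.All.Properties as Allₚ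
open import Data.Bool using (Bool; true; false; T; if_then_else_; _∧_; _∨_; not)
import Data.Bool.Properties as Boolₚ
open import Data.Product using (_×_; _,_; proj₁; proj₂)
open import Data.Sum using (_⊎_; inj₁; inj₂)
open import Data.Empty using (⊥-elim)
open import Function using (_∘_; const; id)
open import Relation.Nullary using (¬_; yes; no)
open import Relation.Binary using (tri<; tri≈; tri>)
open import Relation.Binary.PropositionalEquality
  using (_≢_; refl; sym; trans; cong; cong₂; subst; subst₂; _≗_; _→-setoid_; module ≡-Reasoning)
import Relation.Binary.Reasoning.Setoid as SetoidReasoning

open +-*-Solver using (solve; _:+_; _:*_; _:-_; :-_; _:=_; con)
open ℕSolver.+-*-Solver using ()
  renaming (solve to ℕsolve; _:+_ to _⊞_; _:*_ to _⊠_; _:=_ to _⊜_; con to ℕcon)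

T⇒≡true : ∀ {b} → T b → b ≡ true
T⇒≡true {true} _ = refl

¬T⇒≡false : ∀ {b} → ¬ T b → b ≡ false
¬T⇒≡false {true}  ¬t = ⊥-elim (¬t _)
¬T⇒≡false {false} _  = refl

≡ᵇ-true : ∀ m → (m ≡ᵇ m) ≡ true
≡ᵇ-true m = T⇒≡true (ℕₚ.≡⇒≡ᵇ m m refl)

≡ᵇ-false : ∀ {m n} → m ≢ n → (m ≡ᵇ n) ≡ false
≡ᵇ-false {m} {n} m≢n = ¬T⇒≡false (m≢n ∘ ℕₚ.≡ᵇ⇒≡ m n)

<ᵇ-true : ∀ {m n} → m < n → (m <ᵇ n) ≡ true
<ᵇ-true = T⇒≡true ∘ ℕₚ.<⇒<ᵇ

<ᵇ-false : ∀ {m n} → n ≤ m → (m <ᵇ n) ≡ false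
<ᵇ-false {m} {n} n≤m = ¬T⇒≡false (λ t → ℕₚ.<⇒≱ (ℕₚ.<ᵇ⇒< m n t) n≤m)

≤ᵇ-true : ∀ {m n} → m ≤ n → (m ≤ᵇ n) ≡ true
≤ᵇ-true = T⇒≡true ∘ ℕₚ.≤⇒≤ᵇ

≤ᵇ-false : ∀ {m n} → n < m → (m ≤ᵇ n) ≡ false
≤ᵇ-false {m} {n} n<m = ¬T⇒≡false (λ t → ℕₚ.<⇒≱ n<m (ℕₚ.≤ᵇ⇒≤ m n t))

data Offset (r : ℕ) : ℕ → Set where
  short : ∀ {b} → b < r → Offset r b
  reach : ∀ d → Offset r (r + d)

offset : ∀ r b → Offset r b
offset zero    b       = reach b
offset (suc r) zero    = short (s≤s z≤n)
offset (suc r) (suc b) with offset r b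
... | short b<r = short (s≤s b<r)
... | reach d   = reach d

sign-even : ∀ k → sign (k * 2) ≡ 1ℤ
sign-even zero    = refl
sign-even (suc k) = trans (ℤₚ.neg-involutive _) (sign-even k)

sign-odd : ∀ r → r % 2 ≡ 1 → sign r ≡ -1ℤ
sign-odd r r-odd = begin
  sign r                   ≡⟨ cong sign (DivMod.m≡m%n+[m/n]*n r 2) ⟩
  sign (r % 2 + r / 2 * 2) ≡⟨ cong (λ b → sign (b + r / 2 * 2)) r-odd ⟩
  ℤ.- sign (r / 2 * 2)     ≡⟨ cong ℤ.-_ (sign-even (r / 2)) ⟩
  -1ℤ                      ∎
  where open ≡-Reasoning

sign-2^ : ∀ t → sign (2 ^ suc t) ≡ 1ℤ
sign-2^ t = trans (cong sign (ℕₚ.*-comm 2 (2 ^ t))) (sign-even (2 ^ t))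

-- Power series

Series : Set
Series = ℕ → ℤ

-- multiplication by x^r
shift : ℕ → Series → Series
shift zero    g k       = g k
shift (suc r) g zero    = 0ℤ
shift (suc r) g (suc k) = shift r g k

shift-cong : ∀ r {g h : Series} → g ≗ h → shift r g ≗ shift r h
shift-cong zero    g≗h k       = g≗h k
shift-cong (suc r) g≗h zero    = refl
shift-cong (suc r) g≗h (suc k) = shift-cong r g≗h k

shift-shift : ∀ r s (g : Series) → shift r (shift s g) ≗ shift (r + s) g
shift-shift zero    s g k       = refl
shift-shift (suc r) s g zero    = refl
shift-shift (suc r) s g (suc k) = shift-shift r s g k

shift-linear : ∀ r (g h : Series) e k →
  shift r (λ i → g i ℤ.+ e ℤ.* h i) k ≡ shift r g k ℤ.+ e ℤ.* shift r h k
shift-linear zero    g h e k       = refl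
shift-linear (suc r) g h e zero    = sym (cong (λ z → 0ℤ ℤ.+ z) (ℤₚ.*-zeroʳ e))
shift-linear (suc r) g h e (suc k) = shift-linear r g h e k

shift-reach : ∀ r (g : Series) d → shift r g (r + d) ≡ g d
shift-reach zero    g d = refl
shift-reach (suc r) g d = shift-reach r g d

shift-short : ∀ r (g : Series) {k} → k < r → shift r g k ≡ 0ℤ
shift-short (suc r) g {zero}  _         = refl
shift-short (suc r) g {suc k} (s≤s k<r) = shift-short r g k<r

mulFactor : ℤ → ℕ → Series → Series
mulFactor e r g k = g k ℤ.+ e ℤ.* shift r g k

mulFactors : (ℕ → ℤ) → List ℕ → Series → Series
mulFactors e []      g = g
mulFactors e (r ∷ μ) g = mulFactor (e r) r (mulFactors e μ g)

mulFactor-cong : ∀ e r {g h : Series} → g ≗ h → mulFactor e r g ≗ mulFactor e r h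
mulFactor-cong e r g≗h k = cong₂ (λ a b → a ℤ.+ e ℤ.* b) (g≗h k) (shift-cong r g≗h k)

mulFactors-cong : ∀ e μ {g h : Series} → g ≗ h → mulFactors e μ g ≗ mulFactors e μ h
mulFactors-cong e []      g≗h = g≗h
mulFactors-cong e (r ∷ μ) g≗h = mulFactor-cong (e r) r (mulFactors-cong e μ g≗h)

mulFactors-coefficients : ∀ {e e′} μ (g : Series) → All (λ r → e r ≡ e′ r) μ →
  mulFactors e μ g ≡ mulFactors e′ μ g
mulFactors-coefficients []      g []         = refl
mulFactors-coefficients (r ∷ μ) g (e≡ ∷ es≡) =
  cong₂ (λ a h → mulFactor a r h) e≡ (mulFactors-coefficients μ g es≡)

mulFactors-++ : ∀ e μ ν (g : Series) → mulFactors e (μ ++ ν) g ≡ mulFactors e μ (mulFactors e ν g)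
mulFactors-++ e []      ν g = refl
mulFactors-++ e (r ∷ μ) ν g = cong (mulFactor (e r) r) (mulFactors-++ e μ ν g)

mulFactor-comm : ∀ e r d s (g : Series) → mulFactor e r (mulFactor d s g) ≗ mulFactor d s (mulFactor e r g)
mulFactor-comm e r d s g k = begin
  g k ℤ.+ d ℤ.* shift s g k ℤ.+ e ℤ.* shift r (mulFactor d s g) k
    ≡⟨ cong (λ z → g k ℤ.+ d ℤ.* shift s g k ℤ.+ e ℤ.* z) (expand r s d) ⟩
  g k ℤ.+ d ℤ.* shift s g k ℤ.+ e ℤ.* (shift r g k ℤ.+ d ℤ.* shift (r + s) g k)
    ≡⟨ swap (g k) (shift s g k) (shift r g k) (shift (r + s) g k) e d ⟩
  g k ℤ.+ e ℤ.* shift r g k ℤ.+ d ℤ.* (shift s g k ℤ.+ e ℤ.* shift (r + s) g k)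
    ≡⟨ cong (λ z → g k ℤ.+ e ℤ.* shift r g k ℤ.+ d ℤ.* (shift s g k ℤ.+ e ℤ.* shift z g k)) (ℕₚ.+-comm r s) ⟩
  g k ℤ.+ e ℤ.* shift r g k ℤ.+ d ℤ.* (shift s g k ℤ.+ e ℤ.* shift (s + r) g k)
    ≡⟨ cong (λ z → g k ℤ.+ e ℤ.* shift r g k ℤ.+ d ℤ.* z) (sym (expand s r e)) ⟩
  g k ℤ.+ e ℤ.* shift r g k ℤ.+ d ℤ.* shift s (mulFactor e r g) k ∎
  where
  open ≡-Reasoning
  expand : ∀ r s c → shift r (mulFactor c s g) k ≡ shift r g k ℤ.+ c ℤ.* shift (r + s) g k
  expand r s c = trans (shift-linear r g (shift s g) c k) (cong (λ z → shift r g k ℤ.+ c ℤ.* z) (shift-shift r s g k))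
  swap : ∀ a b c x e d → a ℤ.+ d ℤ.* b ℤ.+ e ℤ.* (c ℤ.+ d ℤ.* x) ≡ a ℤ.+ e ℤ.* c ℤ.+ d ℤ.* (b ℤ.+ e ℤ.* x)
  swap = solve 6 (λ a b c x e d → a :+ d :* b :+ e :* (c :+ d :* x) := a :+ e :* c :+ d :* (b :+ e :* x)) refl

mulFactor-mulFactors-comm : ∀ e r d μ (g : Series) → mulFactor e r (mulFactors d μ g) ≗ mulFactors d μ (mulFactor e r g)
mulFactor-mulFactors-comm e r d []      g k = refl
mulFactor-mulFactors-comm e r d (s ∷ μ) g k =
  trans (mulFactor-comm e r (d s) s (mulFactors d μ g) k)
        (mulFactor-cong (d s) s (mulFactor-mulFactors-comm e r d μ g) k)

insertDesc-↭ : ∀ x ys → insertDesc x ys ↭ x ∷ ys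
insertDesc-↭ x []       = ↭-refl
insertDesc-↭ x (y ∷ ys) with y ≤ᵇ x
... | true  = ↭-refl
... | false = ↭-trans (↭-prep y (insertDesc-↭ x ys)) (↭-swap y x ↭-refl)

sortDesc-↭ : ∀ μ → sortDesc μ ↭ μ
sortDesc-↭ []      = ↭-refl
sortDesc-↭ (x ∷ μ) = ↭-trans (insertDesc-↭ x (sortDesc μ)) (↭-prep x (sortDesc-↭ μ))

mulFactors-↭ : ∀ e {μ ν} → μ ↭ ν → (g : Series) → mulFactors e μ g ≗ mulFactors e ν g
mulFactors-↭ e ↭.refl              g k = refl
mulFactors-↭ e (↭.prep r μ↭ν)      g k = mulFactor-cong (e r) r (mulFactors-↭ e μ↭ν g) k
mulFactors-↭ e (↭.swap {xs = μ} r s μ↭ν) g k =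
  trans (mulFactor-comm (e r) r (e s) s (mulFactors e μ g) k)
        (mulFactor-cong (e s) s (mulFactor-cong (e r) r (mulFactors-↭ e μ↭ν g)) k)
mulFactors-↭ e (↭.trans μ↭ν ν↭ξ)   g k = trans (mulFactors-↭ e μ↭ν g k) (mulFactors-↭ e ν↭ξ g k)

one : Series
one zero    = 1ℤ
one (suc k) = 0ℤ

-- 1 / (1 - x)
geometric : Series
geometric _ = 1ℤ

-- g(-x)
alternate : Series → Series
alternate g k = sign k ℤ.* g k

-- ∏ (1 + x^r): the coefficient of x^k counts the sub-multisets of μ with sum k
subsetSums : List ℕ → Series
subsetSums μ = mulFactors (const 1ℤ) μ one

-- ∏ (1 - x^r) / (1 - x)
hookSeries : List ℕ → Series
hookSeries μ = mulFactors (const -1ℤ) μ geometric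

twoRowSeries : List ℕ → Series
twoRowSeries μ = mulFactor -1ℤ 1 (subsetSums μ)

alternate-shift : ∀ r (g : Series) k → sign k ℤ.* shift r g k ≡ sign r ℤ.* shift r (alternate g) k
alternate-shift zero    g k       = sym (ℤₚ.*-identityˡ _)
alternate-shift (suc r) g zero    = trans (ℤₚ.*-zeroʳ 1ℤ) (sym (ℤₚ.*-zeroʳ (sign (suc r))))
alternate-shift (suc r) g (suc k) = begin
  ℤ.- sign k ℤ.* shift r g k               ≡⟨ ℤₚ.neg-distribˡ-* (sign k) _ ⟨
  ℤ.- (sign k ℤ.* shift r g k)             ≡⟨ cong ℤ.-_ (alternate-shift r g k) ⟩
  ℤ.- (sign r ℤ.* shift r (alternate g) k) ≡⟨ ℤₚ.neg-distribˡ-* (sign r) _ ⟩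
  ℤ.- sign r ℤ.* shift r (alternate g) k   ∎
  where open ≡-Reasoning

alternate-mulFactor : ∀ e r (g : Series) → alternate (mulFactor e r g) ≗ mulFactor (e ℤ.* sign r) r (alternate g)
alternate-mulFactor e r g k = begin
  sign k ℤ.* (g k ℤ.+ e ℤ.* shift r g k)
    ≡⟨ ℤₚ.*-distribˡ-+ (sign k) (g k) _ ⟩
  alternate g k ℤ.+ sign k ℤ.* (e ℤ.* shift r g k)
    ≡⟨ cong (λ z → alternate g k ℤ.+ z) (commute (sign k) e _) ⟩
  alternate g k ℤ.+ e ℤ.* (sign k ℤ.* shift r g k)
    ≡⟨ cong (λ z → alternate g k ℤ.+ e ℤ.* z) (alternate-shift r g k) ⟩
  alternate g k ℤ.+ e ℤ.* (sign r ℤ.* shift r (alternate g) k)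
    ≡⟨ cong (λ z → alternate g k ℤ.+ z) (ℤₚ.*-assoc e (sign r) _) ⟨
  alternate g k ℤ.+ e ℤ.* sign r ℤ.* shift r (alternate g) k ∎
  where
  open ≡-Reasoning
  commute : ∀ a b c → a ℤ.* (b ℤ.* c) ≡ b ℤ.* (a ℤ.* c)
  commute = solve 3 (λ a b c → a :* (b :* c) := b :* (a :* c)) refl

alternate-mulFactors : ∀ e μ (g : Series) →
  alternate (mulFactors e μ g) ≗ mulFactors (λ r → e r ℤ.* sign r) μ (alternate g)
alternate-mulFactors e []      g k = refl
alternate-mulFactors e (r ∷ μ) g k =
  trans (alternate-mulFactor (e r) r (mulFactors e μ g) k)
        (mulFactor-cong (e r ℤ.* sign r) r (alternate-mulFactors e μ g) k)

mulFactor-alternate-geometric : mulFactor 1ℤ 1 (alternate geometric) ≗ one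
mulFactor-alternate-geometric zero    = refl
mulFactor-alternate-geometric (suc k) = cancel (sign k)
  where
  cancel : ∀ x → ℤ.- x ℤ.* 1ℤ ℤ.+ 1ℤ ℤ.* (x ℤ.* 1ℤ) ≡ 0ℤ
  cancel = solve 1 (λ x → :- x :* con 1ℤ :+ con 1ℤ :* (x :* con 1ℤ) := con 0ℤ) refl

mulFactor-difference-of-squares : ∀ s (g : Series) → mulFactor -1ℤ s (mulFactor 1ℤ s g) ≗ mulFactor -1ℤ (s + s) g
mulFactor-difference-of-squares s g k = begin
  g k ℤ.+ 1ℤ ℤ.* shift s g k ℤ.+ -1ℤ ℤ.* shift s (mulFactor 1ℤ s g) k
    ≡⟨ cong (λ z → g k ℤ.+ 1ℤ ℤ.* shift s g k ℤ.+ -1ℤ ℤ.* z) (shift-linear s g (shift s g) 1ℤ k) ⟩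
  g k ℤ.+ 1ℤ ℤ.* shift s g k ℤ.+ -1ℤ ℤ.* (shift s g k ℤ.+ 1ℤ ℤ.* shift s (shift s g) k)
    ≡⟨ cong (λ z → g k ℤ.+ 1ℤ ℤ.* shift s g k ℤ.+ -1ℤ ℤ.* (shift s g k ℤ.+ 1ℤ ℤ.* z)) (shift-shift s s g k) ⟩
  g k ℤ.+ 1ℤ ℤ.* shift s g k ℤ.+ -1ℤ ℤ.* (shift s g k ℤ.+ 1ℤ ℤ.* shift (s + s) g k)
    ≡⟨ cancel (g k) (shift s g k) (shift (s + s) g k) ⟩
  g k ℤ.+ -1ℤ ℤ.* shift (s + s) g k ∎
  where
  open ≡-Reasoning
  cancel : ∀ a b c → a ℤ.+ 1ℤ ℤ.* b ℤ.+ -1ℤ ℤ.* (b ℤ.+ 1ℤ ℤ.* c) ≡ a ℤ.+ -1ℤ ℤ.* c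
  cancel = solve 3 (λ a b c → a :+ con 1ℤ :* b :+ con -1ℤ :* (b :+ con 1ℤ :* c) := a :+ con -1ℤ :* c) refl

mulFactors-powers2-telescope : ∀ t (g : Series) →
  mulFactor -1ℤ 1 (mulFactor 1ℤ 1 (mulFactors (const 1ℤ) (powers2 (suc t)) g)) ≗ mulFactor -1ℤ (2 ^ suc t) g
mulFactors-powers2-telescope zero    g = mulFactor-difference-of-squares 1 g
mulFactors-powers2-telescope (suc t) g k = begin
  mulFactor -1ℤ 1 (mulFactor 1ℤ 1 (mulFactors (const 1ℤ) (powers2 (suc (suc t))) g)) k
    ≡⟨ cong (λ μ → mulFactor -1ℤ 1 (mulFactor 1ℤ 1 (mulFactors (const 1ℤ) μ g)) k) (sym (applyUpTo-∷ʳ _ t)) ⟩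
  mulFactor -1ℤ 1 (mulFactor 1ℤ 1 (mulFactors (const 1ℤ) (powers2 (suc t) ++ p ∷ []) g)) k
    ≡⟨ cong (λ h → mulFactor -1ℤ 1 (mulFactor 1ℤ 1 h) k) (mulFactors-++ (const 1ℤ) (powers2 (suc t)) (p ∷ []) g) ⟩
  mulFactor -1ℤ 1 (mulFactor 1ℤ 1 (mulFactors (const 1ℤ) (powers2 (suc t)) (mulFactor 1ℤ p g))) k
    ≡⟨ mulFactors-powers2-telescope t (mulFactor 1ℤ p g) k ⟩
  mulFactor -1ℤ p (mulFactor 1ℤ p g) k
    ≡⟨ mulFactor-difference-of-squares p g k ⟩
  mulFactor -1ℤ (p + p) g k
    ≡⟨ cong (λ q → mulFactor -1ℤ q g k) (cong (λ z → p + z) (sym (ℕₚ.+-identityʳ p))) ⟩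
  mulFactor -1ℤ (2 ^ suc (suc t)) g k ∎
  where
  open ≡-Reasoning
  p = 2 ^ suc t

mulFactors-alternate-geometric : ∀ μ → mulFactor 1ℤ 1 (mulFactors (const 1ℤ) μ (alternate geometric)) ≗ subsetSums μ
mulFactors-alternate-geometric μ k =
  trans (mulFactor-mulFactors-comm 1ℤ 1 (const 1ℤ) μ (alternate geometric) k)
        (mulFactors-cong (const 1ℤ) μ mulFactor-alternate-geometric k)

-- Substituting -x turns 1 - x^a into 1 + x^a for odd a, keeps 1 - x^(2^(t+1)), and turns
-- 1/(1 - x) into 1/(1 + x); the latter cancels against 1 - x^(2^(t+1)) up to the factors 1 + x^(2^i).
alternate-hookSeries : ∀ a t m → All (λ x → x % 2 ≡ 1) a →
  alternate (hookSeries (sortDesc (a ++ 2 ^ suc t ∷ []) ++ replicate m 1))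
    ≗ twoRowSeries (sortDesc (a ++ powers2 (suc t)) ++ replicate m 1)
alternate-hookSeries a t m a-odd = begin
  alternate (hookSeries (sortDesc (a ++ p ∷ []) ++ ones))
    ≈⟨ alternate-mulFactors (const -1ℤ) (sortDesc (a ++ p ∷ []) ++ ones) geometric ⟩
  mulFactors σ (sortDesc (a ++ p ∷ []) ++ ones) ag
    ≈⟨ mulFactors-↭ σ (↭ₚ.++⁺ʳ ones (sortDesc-↭ (a ++ p ∷ []))) ag ⟩
  mulFactors σ ((a ++ p ∷ []) ++ ones) ag
    ≡⟨ cong (λ μ → mulFactors σ μ ag) (++-assoc a (p ∷ []) ones) ⟩
  mulFactors σ (a ++ p ∷ ones) ag
    ≡⟨ mulFactors-++ σ a (p ∷ ones) ag ⟩
  mulFactors σ a (mulFactor (σ p) p (mulFactors σ ones ag))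
    ≡⟨ cong (λ e → mulFactors σ a (mulFactor e p (mulFactors σ ones ag))) (cong (-1ℤ ℤ.*_) (sign-2^ t)) ⟩
  mulFactors σ a (mulFactor -1ℤ p (mulFactors σ ones ag))
    ≡⟨ cong (λ h → mulFactors σ a (mulFactor -1ℤ p h)) (mulFactors-coefficients ones ag (Allₚ.replicate⁺ m refl)) ⟩
  mulFactors σ a (mulFactor -1ℤ p (mulFactors 𝟙 ones ag))
    ≡⟨ mulFactors-coefficients a _ (All.map (λ {r} r-odd → cong (-1ℤ ℤ.*_) (sign-odd r r-odd)) a-odd) ⟩
  mulFactors 𝟙 a (mulFactor -1ℤ p (mulFactors 𝟙 ones ag))
    ≈⟨ mulFactors-cong 𝟙 a (mulFactors-powers2-telescope t _) ⟨
  mulFactors 𝟙 a (mulFactor -1ℤ 1 (mulFactor 1ℤ 1 (mulFactors 𝟙 powers (mulFactors 𝟙 ones ag))))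
    ≡⟨ cong (λ h → mulFactors 𝟙 a (mulFactor -1ℤ 1 (mulFactor 1ℤ 1 h))) (mulFactors-++ 𝟙 powers ones ag) ⟨
  mulFactors 𝟙 a (mulFactor -1ℤ 1 (mulFactor 1ℤ 1 (mulFactors 𝟙 (powers ++ ones) ag)))
    ≈⟨ mulFactors-cong 𝟙 a (mulFactor-cong -1ℤ 1 (mulFactors-alternate-geometric (powers ++ ones))) ⟩
  mulFactors 𝟙 a (twoRowSeries (powers ++ ones))
    ≈⟨ mulFactor-mulFactors-comm -1ℤ 1 𝟙 a _ ⟨
  mulFactor -1ℤ 1 (mulFactors 𝟙 a (subsetSums (powers ++ ones)))
    ≡⟨ cong (mulFactor -1ℤ 1) (mulFactors-++ 𝟙 a (powers ++ ones) one) ⟨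
  twoRowSeries (a ++ powers ++ ones)
    ≡⟨ cong twoRowSeries (++-assoc a powers ones) ⟨
  twoRowSeries ((a ++ powers) ++ ones)
    ≈⟨ mulFactor-cong -1ℤ 1 (mulFactors-↭ 𝟙 (↭ₚ.++⁺ʳ ones (sortDesc-↭ (a ++ powers))) one) ⟨
  twoRowSeries (sortDesc (a ++ powers) ++ ones) ∎
  where
  open SetoidReasoning (ℕ →-setoid ℤ)
  p = 2 ^ suc t
  ones = replicate m 1
  powers = powers2 (suc t)
  ag = alternate geometric
  𝟙 : ℕ → ℤ
  𝟙 = const 1ℤ
  σ : ℕ → ℤ
  σ r = -1ℤ ℤ.* sign r

m+n≡o+p∧n<o⇒p<m : ∀ {m n o p} → m + n ≡ o + p → n < o → p < m
m+n≡o+p∧n<o⇒p<m {m} {n} {o} {p} e n<o =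
  ℕₚ.≰⇒> (λ m≤p → ℕₚ.<-irrefl (trans e (ℕₚ.+-comm o p)) (ℕₚ.+-mono-≤-< m≤p n<o))

m+[n+o]≡n+p⇒m+o≡p : ∀ m n o p → m + (n + o) ≡ n + p → m + o ≡ p
m+[n+o]≡n+p⇒m+o≡p m n o p e =
  ℕₚ.+-cancelˡ-≡ n _ _ (trans (ℕsolve 3 (λ m n o → n ⊞ (m ⊞ o) ⊜ m ⊞ (n ⊞ o)) refl m n o) e)

subsetSums-vanish : ∀ μ {k} → sum μ < k → subsetSums μ k ≡ 0ℤ
subsetSums-vanish []      {suc k} _ = refl
subsetSums-vanish (r ∷ μ) {k}     μ<k with offset r k
... | short k<r = cong₂ (λ a b → a ℤ.+ 1ℤ ℤ.* b)
                    (subsetSums-vanish μ (ℕₚ.≤-<-trans (ℕₚ.m≤n+m (sum μ) r) μ<k)) (shift-short r _ k<r)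
... | reach d   = cong₂ (λ a b → a ℤ.+ 1ℤ ℤ.* b)
                    (subsetSums-vanish μ (ℕₚ.≤-<-trans (ℕₚ.m≤n+m (sum μ) r) μ<k))
                    (trans (shift-reach r _ d) (subsetSums-vanish μ (ℕₚ.+-cancelˡ-< r _ _ μ<k)))

subsetSums-reflect : ∀ μ → (∀ i j → i + j ≡ sum μ → subsetSums μ i ≡ subsetSums μ j) →
  ∀ r i j → i + j ≡ r + sum μ → subsetSums μ i ≡ shift r (subsetSums μ) j
subsetSums-reflect μ symmetric r i j e with offset r j
... | short j<r = trans (subsetSums-vanish μ (m+n≡o+p∧n<o⇒p<m e j<r)) (sym (shift-short r _ j<r))
... | reach d   = trans (symmetric i d (m+[n+o]≡n+p⇒m+o≡p i r d (sum μ) e)) (sym (shift-reach r _ d))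

subsetSums-symmetric : ∀ μ i j → i + j ≡ sum μ → subsetSums μ i ≡ subsetSums μ j
subsetSums-symmetric []      zero zero _ = refl
subsetSums-symmetric (r ∷ μ) i    j    e = begin
  c i ℤ.+ 1ℤ ℤ.* shift r c i
    ≡⟨ cong₂ (λ a b → a ℤ.+ 1ℤ ℤ.* b) (reflect i j e) (sym (reflect j i (trans (ℕₚ.+-comm j i) e))) ⟩
  shift r c j ℤ.+ 1ℤ ℤ.* c j
    ≡⟨ swap (shift r c j) (c j) ⟩
  c j ℤ.+ 1ℤ ℤ.* shift r c j ∎
  where
  open ≡-Reasoning
  c = subsetSums μ
  reflect : ∀ i j → i + j ≡ r + sum μ → c i ≡ shift r c j
  reflect = subsetSums-reflect μ (subsetSums-symmetric μ) r
  swap : ∀ a b → a ℤ.+ 1ℤ ℤ.* b ≡ b ℤ.+ 1ℤ ℤ.* a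
  swap = solve 2 (λ a b → a :+ con 1ℤ :* b := b :+ con 1ℤ :* a) refl

-- subsetSums μ is a palindrome of degree |μ|, so (1 - x) times it is an antipalindrome of degree |μ| + 1.
twoRowSeries-antisymmetric : ∀ μ i j → i + j ≡ suc (sum μ) → twoRowSeries μ i ≡ ℤ.- twoRowSeries μ j
twoRowSeries-antisymmetric μ i j e = begin
  c i ℤ.+ -1ℤ ℤ.* shift 1 c i
    ≡⟨ cong₂ (λ a b → a ℤ.+ -1ℤ ℤ.* b) (reflect i j e) (sym (reflect j i (trans (ℕₚ.+-comm j i) e))) ⟩
  shift 1 c j ℤ.+ -1ℤ ℤ.* c j
    ≡⟨ flip (shift 1 c j) (c j) ⟩
  ℤ.- (c j ℤ.+ -1ℤ ℤ.* shift 1 c j) ∎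
  where
  open ≡-Reasoning
  c = subsetSums μ
  reflect : ∀ i j → i + j ≡ suc (sum μ) → c i ≡ shift 1 c j
  reflect = subsetSums-reflect μ (subsetSums-symmetric μ) 1
  flip : ∀ a b → a ℤ.+ -1ℤ ℤ.* b ≡ ℤ.- (b ℤ.+ -1ℤ ℤ.* a)
  flip = solve 2 (λ a b → a :+ con -1ℤ :* b := :- (b :+ con -1ℤ :* a)) refl

-- Finite sums

∑< : ℕ → Series → ℤ
∑< zero    g = 0ℤ
∑< (suc K) g = g 0 ℤ.+ ∑< K (g ∘ suc)

sumℤ-map-applyUpTo : ∀ (g : Series) f K → sumℤ (map g (applyUpTo f K)) ≡ ∑< K (g ∘ f)
sumℤ-map-applyUpTo g f zero    = refl
sumℤ-map-applyUpTo g f (suc K) = cong (λ z → g (f 0) ℤ.+ z) (sumℤ-map-applyUpTo g (f ∘ suc) K)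

∑<-cong : ∀ K {g h : Series} → (∀ i → i < K → g i ≡ h i) → ∑< K g ≡ ∑< K h
∑<-cong zero    g≡h = refl
∑<-cong (suc K) g≡h = cong₂ ℤ._+_ (g≡h 0 (s≤s z≤n)) (∑<-cong K (λ i i<K → g≡h (suc i) (s≤s i<K)))

∑<-snoc : ∀ K (g : Series) → ∑< (suc K) g ≡ ∑< K g ℤ.+ g K
∑<-snoc zero    g = ℤₚ.+-comm (g 0) 0ℤ
∑<-snoc (suc K) g = trans (cong (λ z → g 0 ℤ.+ z) (∑<-snoc K (g ∘ suc))) (sym (ℤₚ.+-assoc (g 0) _ _))

∑<-+ : ∀ a b (g : Series) → ∑< (a + b) g ≡ ∑< a g ℤ.+ ∑< b (λ i → g (a + i))
∑<-+ zero    b g = sym (ℤₚ.+-identityˡ _)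
∑<-+ (suc a) b g = trans (cong (λ z → g 0 ℤ.+ z) (∑<-+ a b (g ∘ suc))) (sym (ℤₚ.+-assoc (g 0) _ _))

∑<-reverse : ∀ K (g h : Series) → (∀ i j → suc (i + j) ≡ K → g i ≡ h j) → ∑< K g ≡ ∑< K h
∑<-reverse zero    g h g≡h = refl
∑<-reverse (suc K) g h g≡h = begin
  g 0 ℤ.+ ∑< K (g ∘ suc) ≡⟨ cong₂ ℤ._+_ (g≡h 0 K refl) (∑<-reverse K (g ∘ suc) h (λ i j → g≡h (suc i) j ∘ cong suc)) ⟩
  h K ℤ.+ ∑< K h         ≡⟨ ℤₚ.+-comm (h K) _ ⟩
  ∑< K h ℤ.+ h K         ≡⟨ ∑<-snoc K h ⟨
  ∑< (suc K) h           ∎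
  where open ≡-Reasoning

∑<-palindrome : ∀ h m (G : Series) → (∀ i j → suc (i + j) ≡ h + (m + h) → G i ≡ G j) →
  ∑< (h + (m + h)) G ≡ ∑< h G ℤ.+ (∑< m (λ i → G (h + i)) ℤ.+ ∑< h G)
∑<-palindrome h m G G-sym = begin
  ∑< (h + (m + h)) G                                   ≡⟨ ∑<-+ h (m + h) G ⟩
  ∑< h G ℤ.+ ∑< (m + h) (λ i → G (h + i))              ≡⟨ cong (λ z → ∑< h G ℤ.+ z) (∑<-+ m h _) ⟩
  ∑< h G ℤ.+ (middle ℤ.+ ∑< h (λ i → G (h + (m + i)))) ≡⟨ cong (λ z → ∑< h G ℤ.+ (middle ℤ.+ z)) outer ⟩
  ∑< h G ℤ.+ (middle ℤ.+ ∑< h G)                       ∎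
  where
  open ≡-Reasoning
  middle = ∑< m (λ i → G (h + i))
  outer : ∑< h (λ i → G (h + (m + i))) ≡ ∑< h G
  outer = ∑<-reverse h _ G (λ i j e → G-sym (h + (m + i)) j (trans
    (ℕsolve 4 (λ h m i j → ℕcon 1 ⊞ (h ⊞ (m ⊞ i) ⊞ j) ⊜ h ⊞ (m ⊞ (ℕcon 1 ⊞ (i ⊞ j)))) refl h m i j)
    (cong (λ z → h + (m + z)) e)))

parity : ∀ n → n ≡ n / 2 + n / 2 ⊎ n ≡ suc (n / 2 + n / 2)
parity n with n % 2 | DivMod.m≡m%n+[m/n]*n n 2 | DivMod.m%n<n n 2
... | zero        | n≡ | _ = inj₁ (trans n≡ (ℕsolve 1 (λ h → h ⊠ ℕcon 2 ⊜ h ⊞ h) refl (n / 2)))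
... | suc zero    | n≡ | _ = inj₂ (trans n≡ (cong suc (ℕsolve 1 (λ h → h ⊠ ℕcon 2 ⊜ h ⊞ h) refl (n / 2))))
... | suc (suc _) | _  | s≤s (s≤s ())

self-negative : ∀ {x} → x ≡ ℤ.- x → x ≡ 0ℤ
self-negative {+ zero}    _  = refl
self-negative {+ suc _}   ()
self-negative { -[1+ _ ]} ()

sq-neg : ∀ x → sq (ℤ.- x) ≡ sq x
sq-neg = solve 1 (λ x → :- x :* :- x := x :* x) refl

-- The squares of an antipalindrome F_0, …, F_(n+1) are a palindrome, whose middle term vanishes when n is odd.
∑<-squares-antipalindrome : ∀ n (F : Series) → (∀ i j → i + j ≡ suc n → F i ≡ ℤ.- F j) →
  + 2 ℤ.* ∑< (suc (n / 2)) (sq ∘ F) ≡ ∑< (suc (suc n)) (sq ∘ F)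
∑<-squares-antipalindrome n F F-anti = split (parity n)
  where
  open ≡-Reasoning
  G = sq ∘ F
  H = suc (n / 2)
  halves : ∀ m → ∑< m (λ i → G (H + i)) ≡ 0ℤ → suc (suc n) ≡ H + (m + H) → + 2 ℤ.* ∑< H G ≡ ∑< (suc (suc n)) G
  halves m middle size = begin
    + 2 ℤ.* ∑< H G                                  ≡⟨ doubling (∑< H G) _ middle ⟨
    ∑< H G ℤ.+ (∑< m (λ i → G (H + i)) ℤ.+ ∑< H G)  ≡⟨ ∑<-palindrome H m G G-sym ⟨
    ∑< (H + (m + H)) G                               ≡⟨ cong (λ K → ∑< K G) size ⟨
    ∑< (suc (suc n)) G                               ∎
    where
    G-sym : ∀ i j → suc (i + j) ≡ H + (m + H) → G i ≡ G j
    G-sym i j e = trans (cong sq (F-anti i j (ℕₚ.suc-injective (trans e (sym size))))) (sq-neg (F j))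
    doubling : ∀ x y → y ≡ 0ℤ → x ℤ.+ (y ℤ.+ x) ≡ + 2 ℤ.* x
    doubling x y refl = solve 1 (λ x → x :+ (con 0ℤ :+ x) := con (+ 2) :* x) refl x
  split : n ≡ n / 2 + n / 2 ⊎ n ≡ suc (n / 2 + n / 2) → + 2 ℤ.* ∑< H G ≡ ∑< (suc (suc n)) G
  split (inj₁ n≡) = halves 0 refl (trans (cong (suc ∘ suc) n≡)
    (ℕsolve 1 (λ h → ℕcon 2 ⊞ (h ⊞ h) ⊜ (ℕcon 1 ⊞ h) ⊞ (ℕcon 0 ⊞ (ℕcon 1 ⊞ h))) refl (n / 2)))
  split (inj₂ n≡) = halves 1 (cong (λ z → sq z ℤ.+ 0ℤ) (self-negative (F-anti (H + 0) (H + 0) centre))) (trans (cong (suc ∘ suc) n≡)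
    (ℕsolve 1 (λ h → ℕcon 3 ⊞ (h ⊞ h) ⊜ (ℕcon 1 ⊞ h) ⊞ (ℕcon 1 ⊞ (ℕcon 1 ⊞ h))) refl (n / 2)))
    where
    centre : H + 0 + (H + 0) ≡ suc n
    centre = trans (ℕsolve 1 (λ h → (ℕcon 1 ⊞ h ⊞ ℕcon 0) ⊞ (ℕcon 1 ⊞ h ⊞ ℕcon 0) ⊜ ℕcon 2 ⊞ (h ⊞ h)) refl (n / 2))
                   (sym (cong suc n≡))

-- The Murnaghan–Nakayama rule on abaci

∈⇒memb : ∀ {z cs} → z ∈ cs → memb z cs ≡ true
∈⇒memb {z} (here refl) rewrite ≡ᵇ-true z = refl
∈⇒memb {z} {c ∷ _} (there z∈) rewrite ∈⇒memb z∈ = Boolₚ.∨-zeroʳ (z ≡ᵇ c)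

∉⇒memb : ∀ {z cs} → z ∉ cs → memb z cs ≡ false
∉⇒memb {z} {[]}     z∉ = refl
∉⇒memb {z} {c ∷ cs} z∉ rewrite ≡ᵇ-false (z∉ ∘ here) = ∉⇒memb (z∉ ∘ there)

∉-∷ : ∀ {d x : ℕ} {cs} → d ≢ x → d ∉ cs → d ∉ x ∷ cs
∉-∷ d≢x d∉cs (here d≡x)   = d≢x d≡x
∉-∷ d≢x d∉cs (there d∈cs) = d∉cs d∈cs

between-inside : ∀ {lo hi c} cs → lo < c → c < hi → between lo hi (c ∷ cs) ≡ suc (between lo hi cs)
between-inside cs lo<c c<hi rewrite <ᵇ-true lo<c | <ᵇ-true c<hi = refl

between-below : ∀ {lo hi c} cs → c ≤ lo → between lo hi (c ∷ cs) ≡ between lo hi cs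
between-below {lo} {hi} {c} cs c≤lo rewrite <ᵇ-false {lo} {c} c≤lo = refl

between-above : ∀ {lo hi c} cs → hi ≤ c → between lo hi (c ∷ cs) ≡ between lo hi cs
between-above {lo} {hi} {c} cs hi≤c rewrite <ᵇ-false {c} {hi} hi≤c | Boolₚ.∧-zeroʳ (lo <ᵇ c) = refl

between-last-above : ∀ {lo hi b} c → hi ≤ b → between lo hi (c ∷ b ∷ []) ≡ between lo hi (c ∷ [])
between-last-above {lo} {hi} {b} c hi≤b rewrite <ᵇ-false {b} {hi} hi≤b | Boolₚ.∧-zeroʳ (lo <ᵇ b) = refl

replaceBead-here : ∀ b b′ cs → replaceBead b b′ (b ∷ cs) ≡ b′ ∷ cs
replaceBead-here b b′ cs rewrite ≡ᵇ-true b = refl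

replaceBead-there : ∀ {b c} b′ cs → c ≢ b → replaceBead b b′ (c ∷ cs) ≡ c ∷ replaceBead b b′ cs
replaceBead-there b′ cs c≢b rewrite ≡ᵇ-false c≢b = refl

stripTerm : List ℕ → ℕ → List ℕ → ℕ → ℤ
stripTerm β r μ b = if (r ≤ᵇ b) ∧ not (memb (b ∸ r) β)
                      then sign (between (b ∸ r) b β) ℤ.* χβ (replaceBead b (b ∸ r) β) μ
                      else 0ℤ

χβ-∷ : ∀ β r μ → χβ β (r ∷ μ) ≡ sumℤ (map (stripTerm β r μ) β)
χβ-∷ β r μ = refl

stripTerm-short : ∀ β {r} μ {b} → b < r → stripTerm β r μ b ≡ 0ℤ
stripTerm-short β μ b<r rewrite ≤ᵇ-false b<r = refl

stripTerm-blocked : ∀ {β} r μ {d} → d ∈ β → stripTerm β r μ (r + d) ≡ 0ℤ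
stripTerm-blocked r μ {d} d∈β
  rewrite ℕₚ.m+n∸m≡n r d | ∈⇒memb d∈β | Boolₚ.∧-zeroʳ (r ≤ᵇ r + d) = refl

stripTerm-move : ∀ {β} r μ {d} → d ∉ β →
  stripTerm β r μ (r + d) ≡ sign (between d (r + d) β) ℤ.* χβ (replaceBead (r + d) d β) μ
stripTerm-move r μ {d} d∉β rewrite ℕₚ.m+n∸m≡n r d | ∉⇒memb d∉β | ≤ᵇ-true (ℕₚ.m≤m+n r d) = refl

-- Two-row characters

-- With y < x, the beads {x, y} form the abacus of the two-row shape (x - 1, y).
TwoBeadFormula : List ℕ → Set
TwoBeadFormula μ = ∀ x y → y < x → x + y ≡ suc (sum μ) →
  χβ (x ∷ y ∷ []) μ ≡ c y ℤ.- c x × χβ (y ∷ x ∷ []) μ ≡ c y ℤ.- c x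
  where c = subsetSums μ

stripTerm-pair-head : ∀ {r} μ d c → 1 ≤ r → d ≢ c →
  stripTerm (r + d ∷ c ∷ []) r μ (r + d) ≡ sign (between d (r + d) (c ∷ [])) ℤ.* χβ (d ∷ c ∷ []) μ
stripTerm-pair-head {r} μ d c r≥1 d≢c =
  trans (stripTerm-move r μ (∉-∷ (ℕₚ.<⇒≢ (ℕₚ.m<n+m d r≥1)) (∉-∷ d≢c λ ())))
        (cong₂ (λ k β → sign k ℤ.* χβ β μ) (between-above {d} {r + d} (c ∷ []) ℕₚ.≤-refl)
               (replaceBead-here (r + d) d (c ∷ [])))

stripTerm-pair-tail : ∀ {r} μ d c → 1 ≤ r → d ≢ c → c ≢ r + d →
  stripTerm (c ∷ r + d ∷ []) r μ (r + d) ≡ sign (between d (r + d) (c ∷ [])) ℤ.* χβ (c ∷ d ∷ []) μ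
stripTerm-pair-tail {r} μ d c r≥1 d≢c c≢b =
  trans (stripTerm-move r μ (∉-∷ d≢c (∉-∷ (ℕₚ.<⇒≢ (ℕₚ.m<n+m d r≥1)) λ ())))
        (cong₂ (λ k β → sign k ℤ.* χβ β μ) (between-last-above {d} {r + d} c ℕₚ.≤-refl)
               (trans (replaceBead-there d (r + d ∷ []) c≢b) (cong (c ∷_) (replaceBead-here (r + d) d []))))

m+n+o≡1+[m+p]⇒n+o≡1+p : ∀ m n o p → m + n + o ≡ suc (m + p) → n + o ≡ suc p
m+n+o≡1+[m+p]⇒n+o≡1+p m n o p e = ℕₚ.+-cancelˡ-≡ m _ _ (trans (sym (ℕₚ.+-assoc m n o)) (trans e (sym (ℕₚ.+-suc m p))))

subsetSums-vanish-partner : ∀ μ {r x y} → x + y ≡ suc (r + sum μ) → x < r → subsetSums μ y ≡ 0ℤ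
subsetSums-vanish-partner μ {r} {x} {y} e x<r = subsetSums-vanish μ (ℕₚ.<-trans (ℕₚ.n<1+n (sum μ))
  (m+n≡o+p∧n<o⇒p<m (trans (ℕₚ.+-comm y x) (trans e (sym (ℕₚ.+-suc r (sum μ))))) x<r))

-- When d < y the moving bead jumps over y, which costs a sign.
upperBead-moved : ∀ {r d y} (c : Series) {v} → y < r + d → d ≢ y →
  (d < y → v ≡ c d ℤ.- c y) → (y < d → v ≡ c y ℤ.- c d) →
  sign (between d (r + d) (y ∷ [])) ℤ.* v ≡ c y ℤ.- c d
upperBead-moved {r} {d} {y} c {v} y<x d≢y below above with ℕₚ.<-cmp d y
... | tri< d<y _ _ rewrite between-inside {d} {r + d} [] d<y y<x | below d<y =
  solve 2 (λ a b → con -1ℤ :* (a :- b) := b :- a) refl (c d) (c y)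
... | tri≈ _ d≡y _ = ⊥-elim (d≢y d≡y)
... | tri> _ _ y<d rewrite between-below {d} {r + d} [] (ℕₚ.<⇒≤ y<d) | above y<d = ℤₚ.*-identityˡ _

upperBead-terms : ∀ μ {r x y} → TwoBeadFormula μ → 1 ≤ r → y < x → x + y ≡ suc (r + sum μ) →
  let v = subsetSums μ y ℤ.- shift r (subsetSums μ) x in
  stripTerm (x ∷ y ∷ []) r μ x ≡ v × stripTerm (y ∷ x ∷ []) r μ x ≡ v
upperBead-terms μ {r} {x} {y} ih r≥1 y<x e with offset r x
... | short x<r = trans (stripTerm-short _ μ x<r) zero≡ , trans (stripTerm-short _ μ x<r) zero≡
  where
  zero≡ : 0ℤ ≡ subsetSums μ y ℤ.- shift r (subsetSums μ) x
  zero≡ = sym (cong₂ ℤ._-_ (subsetSums-vanish-partner μ e x<r) (shift-short r _ x<r))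
... | reach d with d ℕₚ.≟ y
...   | yes refl = trans (stripTerm-blocked r μ (there (here refl))) zero≡
               , trans (stripTerm-blocked r μ (here refl)) zero≡
  where
  zero≡ : 0ℤ ≡ subsetSums μ d ℤ.- shift r (subsetSums μ) (r + d)
  zero≡ = sym (trans (cong (λ z → subsetSums μ d ℤ.- z) (shift-reach r _ d)) (ℤₚ.+-inverseʳ (subsetSums μ d)))
...   | no d≢y =
  trans (stripTerm-pair-head μ d y r≥1 d≢y)
        (trans (upperBead-moved c y<x d≢y (λ d<y → proj₂ (ih y d d<y e′)) (λ y<d → proj₁ (ih d y y<d e″))) back)
  , trans (stripTerm-pair-tail μ d y r≥1 d≢y (ℕₚ.<⇒≢ y<x))
          (trans (upperBead-moved c y<x d≢y (λ d<y → proj₁ (ih y d d<y e′)) (λ y<d → proj₂ (ih d y y<d e″))) back)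
  where
  c = subsetSums μ
  e″ : d + y ≡ suc (sum μ)
  e″ = m+n+o≡1+[m+p]⇒n+o≡1+p r d y (sum μ) e
  e′ : y + d ≡ suc (sum μ)
  e′ = trans (ℕₚ.+-comm y d) e″
  back : c y ℤ.- c d ≡ c y ℤ.- shift r c (r + d)
  back = cong (λ z → c y ℤ.- z) (sym (shift-reach r c d))

lowerBead-terms : ∀ μ {r x y} → TwoBeadFormula μ → 1 ≤ r → y < x → x + y ≡ suc (r + sum μ) →
  let w = shift r (subsetSums μ) y ℤ.- subsetSums μ x in
  stripTerm (y ∷ x ∷ []) r μ y ≡ w × stripTerm (x ∷ y ∷ []) r μ y ≡ w
lowerBead-terms μ {r} {x} {y} ih r≥1 y<x e with offset r y
... | short y<r = trans (stripTerm-short _ μ y<r) zero≡ , trans (stripTerm-short _ μ y<r) zero≡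
  where
  zero≡ : 0ℤ ≡ shift r (subsetSums μ) y ℤ.- subsetSums μ x
  zero≡ = sym (cong₂ ℤ._-_ (shift-short r _ y<r) (subsetSums-vanish-partner μ (trans (ℕₚ.+-comm y x) e) y<r))
... | reach d =
  trans (stripTerm-pair-head μ d x r≥1 d≢x) (trans (unsigned (proj₂ (ih x d d<x e′))) back)
  , trans (stripTerm-pair-tail μ d x r≥1 d≢x (ℕₚ.<⇒≢ y<x ∘ sym)) (trans (unsigned (proj₁ (ih x d d<x e′))) back)
  where
  c = subsetSums μ
  d<x : d < x
  d<x = ℕₚ.≤-<-trans (ℕₚ.m≤n+m d r) y<x
  d≢x : d ≢ x
  d≢x = ℕₚ.<⇒≢ d<x
  e′ : x + d ≡ suc (sum μ)
  e′ = trans (ℕₚ.+-comm x d) (m+n+o≡1+[m+p]⇒n+o≡1+p r d x (sum μ) (trans (ℕₚ.+-comm (r + d) x) e))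
  unsigned : ∀ {v} → v ≡ c d ℤ.- c x → sign (between d (r + d) (x ∷ [])) ℤ.* v ≡ c d ℤ.- c x
  unsigned v≡ rewrite between-above {d} {r + d} [] (ℕₚ.<⇒≤ y<x) = trans (ℤₚ.*-identityˡ _) v≡
  back : c d ℤ.- c x ≡ shift r c (r + d) ℤ.- c x
  back = cong (λ z → z ℤ.- c x) (sym (shift-reach r c d))

twoBeadFormula : ∀ μ → All (1 ≤_) μ → TwoBeadFormula μ
twoBeadFormula []      _ (suc zero)    zero    _ refl = refl , refl
twoBeadFormula []      _ (suc zero)    (suc y) _ ()
twoBeadFormula []      _ (suc (suc x)) y       _ ()
twoBeadFormula (r ∷ μ) (r≥1 ∷ parts) x y y<x e =
  trans (cong₂ (λ a b → a ℤ.+ (b ℤ.+ 0ℤ)) (proj₁ upper) (proj₂ lower)) (gather (c y) (c x) (shift r c y) (shift r c x))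
  , trans (cong₂ (λ a b → a ℤ.+ (b ℤ.+ 0ℤ)) (proj₁ lower) (proj₂ upper)) (gather′ (c y) (c x) (shift r c y) (shift r c x))
  where
  c = subsetSums μ
  ih : TwoBeadFormula μ
  ih = twoBeadFormula μ parts
  upper : stripTerm (x ∷ y ∷ []) r μ x ≡ c y ℤ.- shift r c x × stripTerm (y ∷ x ∷ []) r μ x ≡ c y ℤ.- shift r c x
  upper = upperBead-terms μ ih r≥1 y<x e
  lower : stripTerm (y ∷ x ∷ []) r μ y ≡ shift r c y ℤ.- c x × stripTerm (x ∷ y ∷ []) r μ y ≡ shift r c y ℤ.- c x
  lower = lowerBead-terms μ ih r≥1 y<x e
  gather : ∀ a b a′ b′ → (a ℤ.- b′) ℤ.+ ((a′ ℤ.- b) ℤ.+ 0ℤ) ≡ (a ℤ.+ 1ℤ ℤ.* a′) ℤ.- (b ℤ.+ 1ℤ ℤ.* b′)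
  gather = solve 4 (λ a b a′ b′ →
    (a :- b′) :+ ((a′ :- b) :+ con 0ℤ) := (a :+ con 1ℤ :* a′) :- (b :+ con 1ℤ :* b′)) refl
  gather′ : ∀ a b a′ b′ → (a′ ℤ.- b) ℤ.+ ((a ℤ.- b′) ℤ.+ 0ℤ) ≡ (a ℤ.+ 1ℤ ℤ.* a′) ℤ.- (b ℤ.+ 1ℤ ℤ.* b′)
  gather′ = solve 4 (λ a b a′ b′ →
    (a′ :- b) :+ ((a :- b′) :+ con 0ℤ) := (a :+ con 1ℤ :* a′) :- (b :+ con 1ℤ :* b′)) refl

twoRowCharacter : ∀ ν n j → All (1 ≤_) ν → sum ν ≡ n → j + j ≤ n → χ ((n ∸ j) ∷ j ∷ []) ν ≡ twoRowSeries ν j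
twoRowCharacter ν n j parts ν⊢n j+j≤n = begin
  χβ (n ∸ j + 1 ∷ j + 0 ∷ []) ν         ≡⟨ proj₁ (twoBeadFormula ν parts (n ∸ j + 1) (j + 0) lower<upper beads-sum) ⟩
  c (j + 0) ℤ.- c (n ∸ j + 1)           ≡⟨ cong₂ (λ a b → c a ℤ.- b) (ℕₚ.+-identityʳ j) upper≡ ⟩
  c j ℤ.- shift 1 c j                   ≡⟨ solve 2 (λ a b → a :- b := a :+ con -1ℤ :* b) refl (c j) (shift 1 c j) ⟩
  c j ℤ.+ -1ℤ ℤ.* shift 1 c j           ∎
  where
  open ≡-Reasoning
  c = subsetSums ν
  complement : n ∸ j + j ≡ sum ν
  complement = trans (ℕₚ.m∸n+n≡m (ℕₚ.m+n≤o⇒m≤o j j+j≤n)) (sym ν⊢n)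
  beads-sum : n ∸ j + 1 + (j + 0) ≡ suc (sum ν)
  beads-sum = trans (ℕsolve 2 (λ a j → a ⊞ ℕcon 1 ⊞ (j ⊞ ℕcon 0) ⊜ ℕcon 1 ⊞ (a ⊞ j)) refl (n ∸ j) j)
                    (cong suc complement)
  lower<upper : j + 0 < n ∸ j + 1
  lower<upper = subst₂ _<_ (sym (ℕₚ.+-identityʳ j)) (ℕₚ.+-comm 1 (n ∸ j)) (s≤s (ℕₚ.m+n≤o⇒m≤o∸n j j+j≤n))
  upper≡ : c (n ∸ j + 1) ≡ shift 1 c j
  upper≡ = subsetSums-reflect ν (subsetSums-symmetric ν) 1 (n ∸ j + 1) j
    (trans (ℕsolve 2 (λ a j → a ⊞ ℕcon 1 ⊞ j ⊜ ℕcon 1 ⊞ (a ⊞ j)) refl (n ∸ j) j) (cong suc complement))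

-- Hook characters

replaceBead-∈ : ∀ {b h z} τ → Unique τ → z ∈ replaceBead b h τ → z ≡ h ⊎ (z ∈ τ × z ≢ b)
replaceBead-∈ {b} {h} (c ∷ cs) (c∉cs ∷ u) z∈ with c ℕₚ.≟ b
... | yes refl rewrite replaceBead-here c h cs = case z∈
  where
  case : _ ∈ h ∷ cs → _
  case (here z≡h)   = inj₁ z≡h
  case (there z∈cs) = inj₂ (there z∈cs , λ z≡c → All.lookup c∉cs z∈cs (sym z≡c))
... | no c≢b rewrite replaceBead-there h cs c≢b = case z∈
  where
  case : _ ∈ c ∷ replaceBead b h cs → _
  case (here z≡c) = inj₂ (here z≡c , λ z≡b → c≢b (trans (sym z≡c) z≡b))
  case (there z∈) with replaceBead-∈ cs u z∈
  ... | inj₁ z≡h          = inj₁ z≡h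
  ... | inj₂ (z∈cs , z≢b) = inj₂ (there z∈cs , z≢b)

replaceBead-new : ∀ {b} h τ → b ∈ τ → h ∈ replaceBead b h τ
replaceBead-new {b} h (c ∷ cs) b∈ with c ℕₚ.≟ b
... | yes refl rewrite replaceBead-here c h cs = here refl
... | no c≢b rewrite replaceBead-there h cs c≢b with b∈
...   | here b≡c   = ⊥-elim (c≢b (sym b≡c))
...   | there b∈cs = there (replaceBead-new h cs b∈cs)

replaceBead-old : ∀ {b z} h τ → z ∈ τ → z ≢ b → z ∈ replaceBead b h τ
replaceBead-old {b} h (c ∷ cs) z∈ z≢b with c ℕₚ.≟ b | z∈
... | yes refl | here z≡c   = ⊥-elim (z≢b z≡c)
... | yes refl | there z∈cs rewrite replaceBead-here c h cs = there z∈cs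
... | no c≢b   | here z≡c   rewrite replaceBead-there h cs c≢b = here z≡c
... | no c≢b   | there z∈cs rewrite replaceBead-there h cs c≢b = there (replaceBead-old h cs z∈cs z≢b)

replaceBead-unique : ∀ {b h} τ → Unique τ → h ∉ τ → Unique (replaceBead b h τ)
replaceBead-unique []       []          h∉ = []
replaceBead-unique {b} {h} (c ∷ cs) (c∉cs ∷ u) h∉ with c ℕₚ.≟ b
... | yes refl rewrite replaceBead-here c h cs = All.tabulate (λ z∈cs h≡z → h∉ (there (subst (_∈ cs) (sym h≡z) z∈cs))) ∷ u
... | no c≢b rewrite replaceBead-there h cs c≢b =
  All.tabulate c≢ ∷ replaceBead-unique cs u (h∉ ∘ there)
  where
  c≢ : ∀ {z} → z ∈ replaceBead b h cs → c ≢ z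
  c≢ z∈ c≡z with replaceBead-∈ cs u z∈
  ... | inj₁ z≡h       = h∉ (here (trans (sym z≡h) (sym c≡z)))
  ... | inj₂ (z∈cs , _) = All.lookup c∉cs z∈cs c≡z

length-replaceBead : ∀ b h τ → length (replaceBead b h τ) ≡ length τ
length-replaceBead b h []       = refl
length-replaceBead b h (c ∷ cs) with c ℕₚ.≟ b
... | yes refl rewrite replaceBead-here c h cs = refl
... | no c≢b   rewrite replaceBead-there h cs c≢b = cong suc (length-replaceBead b h cs)

indicator : Bool → ℕ
indicator b = if b then 1 else 0

count< : ℕ → (ℕ → Bool) → ℕ
count< zero    P = 0
count< (suc M) P = count< M P + indicator (P M)

count<-cong : ∀ M {P Q : ℕ → Bool} → (∀ {z} → z < M → P z ≡ Q z) → count< M P ≡ count< M Q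
count<-cong zero    P≡Q = refl
count<-cong (suc M) P≡Q = cong₂ _+_ (count<-cong M (P≡Q ∘ ℕₚ.m<n⇒m<1+n)) (cong indicator (P≡Q ℕₚ.≤-refl))

count<-false : ∀ M → count< M (const false) ≡ 0
count<-false zero    = refl
count<-false (suc M) = cong (_+ 0) (count<-false M)

count<-∨ : ∀ M (P Q : ℕ → Bool) → (∀ z → P z ∧ Q z ≡ false) →
  count< M (λ z → P z ∨ Q z) ≡ count< M P + count< M Q
count<-∨ zero    P Q disjoint = refl
count<-∨ (suc M) P Q disjoint = begin
  count< M (λ z → P z ∨ Q z) + indicator (P M ∨ Q M)
    ≡⟨ cong₂ _+_ (count<-∨ M P Q disjoint) (split (P M) (Q M) (disjoint M)) ⟩
  count< M P + count< M Q + (indicator (P M) + indicator (Q M))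
    ≡⟨ ℕsolve 4 (λ a b c d → a ⊞ b ⊞ (c ⊞ d) ⊜ a ⊞ c ⊞ (b ⊞ d)) refl (count< M P) (count< M Q) _ _ ⟩
  count< M P + indicator (P M) + (count< M Q + indicator (Q M)) ∎
  where
  open ≡-Reasoning
  split : ∀ a b → a ∧ b ≡ false → indicator (a ∨ b) ≡ indicator a + indicator b
  split true  false _ = refl
  split false b     _ = refl

count<-≡ᵇ : ∀ {c} M (P : ℕ → Bool) → c < M → count< M (λ z → (z ≡ᵇ c) ∧ P z) ≡ indicator (P c)
count<-≡ᵇ {c} (suc M) P c<1+M with ℕₚ.m≤n⇒m<n∨m≡n (ℕₚ.≤-pred c<1+M)
... | inj₁ c<M rewrite ≡ᵇ-false (ℕₚ.<⇒≢ c<M ∘ sym) = trans (ℕₚ.+-identityʳ _) (count<-≡ᵇ M P c<M)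
... | inj₂ refl rewrite ≡ᵇ-true c =
  cong (_+ indicator (P c)) (trans (count<-cong c (λ {z} z<c → cong (_∧ P z) (≡ᵇ-false (ℕₚ.<⇒≢ z<c)))) (count<-false c))

count<-interval : ∀ M lo hi → count< M (λ z → (lo <ᵇ z) ∧ (z <ᵇ hi)) ≡ (M ⊓ hi) ∸ suc lo
count<-interval zero    lo hi = refl
count<-interval (suc M) lo hi with ℕₚ.<-≤-connex M hi
... | inj₂ hi≤M rewrite <ᵇ-false {M} {hi} hi≤M | Boolₚ.∧-zeroʳ (lo <ᵇ M) = begin
  count< M (λ z → (lo <ᵇ z) ∧ (z <ᵇ hi)) + 0 ≡⟨ ℕₚ.+-identityʳ _ ⟩
  count< M (λ z → (lo <ᵇ z) ∧ (z <ᵇ hi))     ≡⟨ count<-interval M lo hi ⟩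
  (M ⊓ hi) ∸ suc lo                           ≡⟨ cong (_∸ suc lo) (ℕₚ.m≥n⇒m⊓n≡n hi≤M) ⟩
  hi ∸ suc lo                                 ≡⟨ cong (_∸ suc lo) (ℕₚ.m≥n⇒m⊓n≡n (ℕₚ.m≤n⇒m≤1+n hi≤M)) ⟨
  (suc M ⊓ hi) ∸ suc lo                       ∎
  where open ≡-Reasoning
... | inj₁ M<hi rewrite <ᵇ-true M<hi | Boolₚ.∧-identityʳ (lo <ᵇ M) | ℕₚ.m≤n⇒m⊓n≡m M<hi
                      | count<-interval M lo hi | ℕₚ.m≤n⇒m⊓n≡m (ℕₚ.<⇒≤ M<hi) with ℕₚ.<-≤-connex lo M
...   | inj₁ lo<M rewrite <ᵇ-true lo<M = trans (sym (ℕₚ.+-∸-comm 1 lo<M)) (cong (_∸ suc lo) (ℕₚ.+-comm M 1))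
...   | inj₂ M≤lo rewrite <ᵇ-false {lo} {M} M≤lo | ℕₚ.m≤n⇒m∸n≡0 M≤lo | ℕₚ.m≤n⇒m∸n≡0 (ℕₚ.m≤n⇒m≤1+n M≤lo)
  = refl

between-count : ∀ {lo hi M} τ → Unique τ → All (_< M) τ →
  between lo hi τ ≡ count< M (λ z → memb z τ ∧ ((lo <ᵇ z) ∧ (z <ᵇ hi)))
between-count {M = M} []       []          []            = sym (count<-false M)
between-count {lo} {hi} {M} (c ∷ cs) (c∉cs ∷ u) (c<M ∷ cs<M) = begin
  indicator (I c) + between lo hi cs
    ≡⟨ cong₂ _+_ (sym (count<-≡ᵇ M I c<M)) (between-count cs u cs<M) ⟩
  count< M (λ z → (z ≡ᵇ c) ∧ I z) + count< M (λ z → memb z cs ∧ I z)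
    ≡⟨ count<-∨ M _ _ disjoint ⟨
  count< M (λ z → ((z ≡ᵇ c) ∧ I z) ∨ (memb z cs ∧ I z))
    ≡⟨ count<-cong M (λ {z} _ → sym (Boolₚ.∧-distribʳ-∨ (I z) (z ≡ᵇ c) (memb z cs))) ⟩
  count< M (λ z → ((z ≡ᵇ c) ∨ memb z cs) ∧ I z) ∎
  where
  open ≡-Reasoning
  I : ℕ → Bool
  I z = (lo <ᵇ z) ∧ (z <ᵇ hi)
  disjoint : ∀ z → ((z ≡ᵇ c) ∧ I z) ∧ (memb z cs ∧ I z) ≡ false
  disjoint z with z ℕₚ.≟ c
  ... | yes refl rewrite ∉⇒memb (λ c∈cs → All.lookup c∉cs c∈cs refl) = Boolₚ.∧-zeroʳ _
  ... | no z≢c   rewrite ≡ᵇ-false z≢c = refl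

record Punctured (L h : ℕ) (τ : List ℕ) : Set where
  field
    unique   : Unique τ
    bounded  : ∀ {z} → z ∈ τ → z < L
    hole     : h ∉ τ
    complete : ∀ {z} → z < L → z ≢ h → z ∈ τ
    size     : suc (length τ) ≡ L

between-punctured : ∀ {L h τ} hi → Punctured L h τ → between h hi τ ≡ (L ⊓ hi) ∸ suc h
between-punctured {L} {h} {τ} hi P = begin
  between h hi τ                                           ≡⟨ between-count τ unique (All.tabulate bounded) ⟩
  count< L (λ z → memb z τ ∧ ((h <ᵇ z) ∧ (z <ᵇ hi)))    ≡⟨ count<-cong L present ⟩
  count< L (λ z → (h <ᵇ z) ∧ (z <ᵇ hi))                 ≡⟨ count<-interval L h hi ⟩
  (L ⊓ hi) ∸ suc h                                         ∎
  where
  open ≡-Reasoning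
  open Punctured P
  present : ∀ {z} → z < L → memb z τ ∧ ((h <ᵇ z) ∧ (z <ᵇ hi)) ≡ (h <ᵇ z) ∧ (z <ᵇ hi)
  present {z} z<L with z ℕₚ.≟ h
  ... | yes refl rewrite <ᵇ-false {z} {z} ℕₚ.≤-refl = Boolₚ.∧-zeroʳ _
  ... | no z≢h   rewrite ∈⇒memb (complete z<L z≢h) = refl

between-all-below : ∀ {lo hi} τ → All (_≤ lo) τ → between lo hi τ ≡ 0
between-all-below []       []              = refl
between-all-below (c ∷ cs) (c≤lo ∷ cs≤lo) = trans (between-below cs c≤lo) (between-all-below cs cs≤lo)

-- emptyβ is defined through a local helper that cannot be named; beadsBelow is that helper,
-- recovered by unification (the with-abstraction separates its two arguments).
mutual
  beadsBelow : List ℕ → List ℕ → Bool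
  beadsBelow = _

  emptyβ-∷ : ∀ c cs → emptyβ (c ∷ cs) ≡ ((c <ᵇ suc (length cs)) ∧ beadsBelow (c ∷ cs) cs)
  emptyβ-∷ c cs with c ∷ cs
  ... | β = refl

beadsBelow-true : ∀ β cs → All (_< length β) cs → beadsBelow β cs ≡ true
beadsBelow-true β []       []          = refl
beadsBelow-true β (c ∷ cs) (c< ∷ cs<) rewrite <ᵇ-true c< = beadsBelow-true β cs cs<

χβ-[] : ∀ β → All (_< length β) β → χβ β [] ≡ 1ℤ
χβ-[] []       _ = refl
χβ-[] (c ∷ cs) (c< ∷ cs<) rewrite emptyβ-∷ c cs | <ᵇ-true c< | beadsBelow-true (c ∷ cs) cs cs< = refl

sumℤ-map-zero : ∀ (f : ℕ → ℤ) τ → (∀ {b} → b ∈ τ → f b ≡ 0ℤ) → sumℤ (map f τ) ≡ 0ℤ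
sumℤ-map-zero f []       vanish = refl
sumℤ-map-zero f (c ∷ cs) vanish = cong₂ ℤ._+_ (vanish (here refl)) (sumℤ-map-zero f cs (vanish ∘ there))

sumℤ-map-single : ∀ (f : ℕ → ℤ) τ {c} → Unique τ → c ∈ τ → (∀ {b} → b ∈ τ → b ≢ c → f b ≡ 0ℤ) →
  sumℤ (map f τ) ≡ f c
sumℤ-map-single f (c ∷ cs) (c∉cs ∷ u) (here refl) vanish =
  trans (cong (λ z → f c ℤ.+ z) (sumℤ-map-zero f cs (λ b∈ → vanish (there b∈) (All.lookup c∉cs b∈ ∘ sym))))
        (ℤₚ.+-identityʳ (f c))
sumℤ-map-single f (c′ ∷ cs) (c′∉cs ∷ u) (there c∈) vanish =
  trans (cong₂ ℤ._+_ (vanish (here refl) (All.lookup c′∉cs c∈)) (sumℤ-map-single f cs u c∈ (vanish ∘ there)))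
        (ℤₚ.+-identityˡ _)

hookSeries-vanish : ∀ r μ {k} → r + sum μ ≤ k → hookSeries (r ∷ μ) k ≡ 0ℤ
hookSeries-vanish r μ {k} r+μ≤k with offset r k
... | short k<r = ⊥-elim (ℕₚ.<⇒≱ k<r (ℕₚ.m+n≤o⇒m≤o r r+μ≤k))
... | reach d rewrite shift-reach r (hookSeries μ) d with μ
...   | []    = refl
...   | s ∷ ν = cong₂ (λ a b → a ℤ.+ -1ℤ ℤ.* b) (hookSeries-vanish s ν (ℕₚ.m+n≤o⇒n≤o r r+μ≤k))
                                                (hookSeries-vanish s ν (ℕₚ.+-cancelˡ-≤ r _ _ r+μ≤k))

punctured-move : ∀ {L h c τ} → Punctured L h τ → h < L → c < L → c ≢ h → Punctured L c (replaceBead c h τ)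
punctured-move {L} {h} {c} {τ} P h<L c<L c≢h = record
  { unique   = replaceBead-unique τ unique hole
  ; bounded  = bounded′
  ; hole     = hole′
  ; complete = complete′
  ; size     = trans (cong suc (length-replaceBead c h τ)) size
  }
  where
  open Punctured P
  bounded′ : ∀ {z} → z ∈ replaceBead c h τ → z < L
  bounded′ z∈ with replaceBead-∈ τ unique z∈
  ... | inj₁ refl     = h<L
  ... | inj₂ (z∈τ , _) = bounded z∈τ
  hole′ : c ∉ replaceBead c h τ
  hole′ c∈ with replaceBead-∈ τ unique c∈
  ... | inj₁ c≡h       = c≢h c≡h
  ... | inj₂ (_ , c≢c) = c≢c refl
  complete′ : ∀ {z} → z < L → z ≢ c → z ∈ replaceBead c h τ
  complete′ {z} z<L z≢c with z ℕₚ.≟ h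
  ... | yes refl = replaceBead-new z τ (complete c<L c≢h)
  ... | no z≢h   = replaceBead-old h τ (complete z<L z≢h) z≢c

-- τ fills {0, …, L - 1} except for the gap h, so p ∷ τ is the abacus of a hook with leg length ℓ.
HookFormula : List ℕ → Set
HookFormula μ = ∀ {L h ℓ p τ} → Punctured L h τ → L ≡ suc (h + ℓ) → p ≡ h + sum μ → L ≤ p →
  χβ (p ∷ τ) μ ≡ alternate (hookSeries μ) ℓ

topBead-term : ∀ {r} μ {L h ℓ p τ} → All (1 ≤_) μ → HookFormula μ → 1 ≤ r →
  Punctured L h τ → L ≡ suc (h + ℓ) → p ≡ r + (h + sum μ) → L ≤ p →
  stripTerm (p ∷ τ) r μ p ≡ alternate (hookSeries μ) ℓ
topBead-term {r} [] {L} {h} {ℓ} {τ = τ} _ _ r≥1 P refl refl L≤p rewrite ℕₚ.+-identityʳ h = begin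
  stripTerm (r + h ∷ τ) r [] (r + h)
    ≡⟨ stripTerm-move r [] (∉-∷ (ℕₚ.<⇒≢ (ℕₚ.<-≤-trans (s≤s (ℕₚ.m≤m+n h ℓ)) L≤p)) hole) ⟩
  sign (between h (r + h) (r + h ∷ τ)) ℤ.* χβ (replaceBead (r + h) h (r + h ∷ τ)) []
    ≡⟨ cong₂ (λ k β → sign k ℤ.* χβ β [])
             (trans (between-above {hi = r + h} τ ℕₚ.≤-refl) (between-punctured (r + h) P))
             (replaceBead-here (r + h) h τ) ⟩
  sign (L ⊓ (r + h) ∸ suc h) ℤ.* χβ (h ∷ τ) []
    ≡⟨ cong₂ (λ k v → sign k ℤ.* v) (cong (_∸ suc h) (ℕₚ.m≤n⇒m⊓n≡m L≤p)) (χβ-[] (h ∷ τ) all-below) ⟩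
  sign (L ∸ suc h) ℤ.* 1ℤ
    ≡⟨ cong (λ k → sign k ℤ.* 1ℤ) (ℕₚ.m+n∸m≡n (suc h) ℓ) ⟩
  alternate geometric ℓ ∎
  where
  open ≡-Reasoning
  open Punctured P
  all-below : All (_< length (h ∷ τ)) (h ∷ τ)
  all-below = subst (λ n → All (_< n) (h ∷ τ)) (sym size) (s≤s (ℕₚ.m≤m+n h ℓ) ∷ All.tabulate bounded)
topBead-term {r} (s ∷ μ) {L} {h} {ℓ} {τ = τ} (s≥1 ∷ _) ih r≥1 P L≡ refl L≤p with ℕₚ.<-≤-connex (h + sum (s ∷ μ)) L
... | inj₁ q<L = trans (stripTerm-blocked r (s ∷ μ) (there (complete q<L q≢h))) (sym vanish)
  where
  open Punctured P
  q≢h : h + sum (s ∷ μ) ≢ h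
  q≢h = ℕₚ.<⇒≢ (ℕₚ.m<m+n h (ℕₚ.≤-trans s≥1 (ℕₚ.m≤m+n s (sum μ)))) ∘ sym
  vanish : alternate (hookSeries (s ∷ μ)) ℓ ≡ 0ℤ
  vanish = trans (cong (sign ℓ ℤ.*_) (hookSeries-vanish s μ
             (ℕₚ.+-cancelˡ-≤ h _ _ (ℕₚ.≤-pred (subst (h + sum (s ∷ μ) <_) L≡ q<L))))) (ℤₚ.*-zeroʳ (sign ℓ))
... | inj₂ L≤q = begin
  stripTerm (r + q ∷ τ) r (s ∷ μ) (r + q)
    ≡⟨ stripTerm-move r (s ∷ μ) (∉-∷ (ℕₚ.<⇒≢ (ℕₚ.m<n+m q r≥1)) (λ q∈ → ℕₚ.<⇒≱ (bounded q∈) L≤q)) ⟩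
  sign (between q (r + q) (r + q ∷ τ)) ℤ.* χβ (replaceBead (r + q) q (r + q ∷ τ)) (s ∷ μ)
    ≡⟨ cong₂ (λ k β → sign k ℤ.* χβ β (s ∷ μ))
             (trans (between-above {hi = r + q} τ ℕₚ.≤-refl)
                    (between-all-below τ (All.tabulate (λ z∈ → ℕₚ.<⇒≤ (ℕₚ.<-≤-trans (bounded z∈) L≤q)))))
             (replaceBead-here (r + q) q τ) ⟩
  1ℤ ℤ.* χβ (q ∷ τ) (s ∷ μ)
    ≡⟨ ℤₚ.*-identityˡ _ ⟩
  χβ (q ∷ τ) (s ∷ μ)
    ≡⟨ ih P L≡ refl L≤q ⟩
  alternate (hookSeries (s ∷ μ)) ℓ ∎
  where
  open ≡-Reasoning
  open Punctured P
  q = h + sum (s ∷ μ)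

stripTerm-punctured : ∀ {r} μ {L h p τ b} → Punctured L h τ → b ∈ τ → b ≢ r + h → stripTerm (p ∷ τ) r μ b ≡ 0ℤ
stripTerm-punctured {r} μ {h = h} {b = b} P b∈ b≢r+h with offset r b
... | short b<r = stripTerm-short _ μ b<r
... | reach d with d ℕₚ.≟ h
...   | yes refl = ⊥-elim (b≢r+h refl)
...   | no d≢h   = stripTerm-blocked r μ (there (complete (ℕₚ.≤-<-trans (ℕₚ.m≤n+m d r) (bounded b∈)) d≢h))
  where open Punctured P

-- The bead r + h drops into the gap h over r - 1 beads, and leaves its own position as the new gap.
gapBead-term : ∀ {r} μ {L h ℓ′ p τ} → HookFormula μ → Punctured L h τ → L ≡ suc (h + (suc r + ℓ′)) →
  p ≡ h + (suc r + sum μ) → L ≤ p → stripTerm (p ∷ τ) (suc r) μ (suc r + h) ≡ sign r ℤ.* alternate (hookSeries μ) ℓ′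
gapBead-term {r} μ {L} {h} {ℓ′} {p} {τ} ih P L≡ p≡ L≤p = begin
  stripTerm (p ∷ τ) (suc r) μ c
    ≡⟨ stripTerm-move (suc r) μ (∉-∷ (ℕₚ.<⇒≢ (ℕₚ.<-≤-trans h<L L≤p)) hole) ⟩
  sign (between h c (p ∷ τ)) ℤ.* χβ (replaceBead c h (p ∷ τ)) μ
    ≡⟨ cong₂ (λ k β → sign k ℤ.* χβ β μ)
             (trans (between-above {hi = c} τ (ℕₚ.<⇒≤ c<p)) (trans (between-punctured c P) jump))
             (replaceBead-there h τ (ℕₚ.<⇒≢ c<p ∘ sym)) ⟩
  sign r ℤ.* χβ (p ∷ replaceBead c h τ) μ
    ≡⟨ cong (sign r ℤ.*_) (ih (punctured-move P h<L c<L c≢h) L≡′ p≡′ L≤p) ⟩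
  sign r ℤ.* alternate (hookSeries μ) ℓ′ ∎
  where
  open ≡-Reasoning
  open Punctured P
  c = suc r + h
  L≡′ : L ≡ suc (c + ℓ′)
  L≡′ = trans L≡ (cong suc (ℕsolve 3 (λ h r l → h ⊞ (ℕcon 1 ⊞ r ⊞ l) ⊜ ℕcon 1 ⊞ r ⊞ h ⊞ l) refl h r ℓ′))
  p≡′ : p ≡ c + sum μ
  p≡′ = trans p≡ (ℕsolve 3 (λ h r s → h ⊞ (ℕcon 1 ⊞ r ⊞ s) ⊜ ℕcon 1 ⊞ r ⊞ h ⊞ s) refl h r (sum μ))
  h<L : h < L
  h<L = subst (h <_) (sym L≡) (s≤s (ℕₚ.m≤m+n h _))
  c<L : c < L
  c<L = subst (c <_) (sym L≡′) (s≤s (ℕₚ.m≤m+n c ℓ′))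
  c<p : c < p
  c<p = ℕₚ.<-≤-trans c<L L≤p
  c≢h : c ≢ h
  c≢h = ℕₚ.<⇒≢ (ℕₚ.m<n+m h (s≤s z≤n)) ∘ sym
  jump : (L ⊓ c) ∸ suc h ≡ r
  jump = trans (cong (_∸ suc h) (ℕₚ.m≥n⇒m⊓n≡n (ℕₚ.<⇒≤ c<L))) (ℕₚ.m+n∸n≡m r h)

-- Apart from r + h, every bead of τ would land on another bead or below 0.
lowerBeads-sum : ∀ {r} μ {L h ℓ p τ} → HookFormula μ → 1 ≤ r →
  Punctured L h τ → L ≡ suc (h + ℓ) → p ≡ h + (r + sum μ) → L ≤ p →
  sumℤ (map (stripTerm (p ∷ τ) r μ) τ) ≡ (-1ℤ ℤ.* sign r) ℤ.* shift r (alternate (hookSeries μ)) ℓ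
lowerBeads-sum {suc r} μ {L} {h} {ℓ} {p} {τ} ih (s≤s z≤n) P refl p≡ L≤p with offset (suc r) ℓ
... | short ℓ<r = begin
  sumℤ (map (stripTerm (p ∷ τ) (suc r) μ) τ)
    ≡⟨ sumℤ-map-zero _ τ (λ b∈ → stripTerm-punctured μ P b∈ (ℕₚ.<⇒≢ (ℕₚ.<-≤-trans (bounded b∈) gap-high))) ⟩
  0ℤ
    ≡⟨ ℤₚ.*-zeroʳ (-1ℤ ℤ.* sign (suc r)) ⟨
  (-1ℤ ℤ.* sign (suc r)) ℤ.* 0ℤ
    ≡⟨ cong (λ z → (-1ℤ ℤ.* sign (suc r)) ℤ.* z) (shift-short (suc r) _ ℓ<r) ⟨
  (-1ℤ ℤ.* sign (suc r)) ℤ.* shift (suc r) (alternate (hookSeries μ)) ℓ ∎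
  where
  open ≡-Reasoning
  open Punctured P
  gap-high : suc (h + ℓ) ≤ suc r + h
  gap-high = subst (_≤ suc r + h) (cong suc (ℕₚ.+-comm ℓ h)) (ℕₚ.+-monoˡ-≤ h ℓ<r)
... | reach ℓ′ = begin
  sumℤ (map (stripTerm (p ∷ τ) (suc r) μ) τ)
    ≡⟨ sumℤ-map-single _ τ unique (complete c<L (ℕₚ.<⇒≢ (ℕₚ.m<n+m h (s≤s z≤n)) ∘ sym)) (stripTerm-punctured μ P) ⟩
  stripTerm (p ∷ τ) (suc r) μ (suc r + h)
    ≡⟨ gapBead-term μ ih P refl p≡ L≤p ⟩
  sign r ℤ.* alternate (hookSeries μ) ℓ′
    ≡⟨ cong (λ z → z ℤ.* alternate (hookSeries μ) ℓ′) (solve 1 (λ x → con -1ℤ :* :- x := x) refl (sign r)) ⟨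
  (-1ℤ ℤ.* sign (suc r)) ℤ.* alternate (hookSeries μ) ℓ′
    ≡⟨ cong (λ z → (-1ℤ ℤ.* sign (suc r)) ℤ.* z) (shift-reach (suc r) _ ℓ′) ⟨
  (-1ℤ ℤ.* sign (suc r)) ℤ.* shift (suc r) (alternate (hookSeries μ)) (suc r + ℓ′) ∎
  where
  open ≡-Reasoning
  open Punctured P
  c<L : suc r + h < suc (h + (suc r + ℓ′))
  c<L = s≤s (subst (_≤ h + (suc r + ℓ′)) (ℕₚ.+-comm h (suc r)) (ℕₚ.+-monoʳ-≤ h (ℕₚ.m≤m+n (suc r) ℓ′)))

hookFormula : ∀ μ → All (1 ≤_) μ → HookFormula μ
hookFormula []      _ {h = h} {ℓ} P refl refl L≤p =
  ⊥-elim (ℕₚ.<⇒≱ (s≤s (ℕₚ.≤-trans (ℕₚ.≤-reflexive (ℕₚ.+-identityʳ h)) (ℕₚ.m≤m+n h ℓ))) L≤p)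
hookFormula (r ∷ μ) (r≥1 ∷ parts) {L} {h} {ℓ} {p} {τ} P L≡ p≡ L≤p = begin
  χβ (p ∷ τ) (r ∷ μ)
    ≡⟨ χβ-∷ (p ∷ τ) r μ ⟩
  stripTerm (p ∷ τ) r μ p ℤ.+ sumℤ (map (stripTerm (p ∷ τ) r μ) τ)
    ≡⟨ cong₂ ℤ._+_ (topBead-term μ parts ih r≥1 P L≡ p≡′ L≤p) (lowerBeads-sum μ ih r≥1 P L≡ p≡ L≤p) ⟩
  alternate S ℓ ℤ.+ (-1ℤ ℤ.* sign r) ℤ.* shift r (alternate S) ℓ
    ≡⟨ alternate-mulFactor -1ℤ r S ℓ ⟨
  alternate (hookSeries (r ∷ μ)) ℓ ∎
  where
  open ≡-Reasoning
  S = hookSeries μ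
  ih : HookFormula μ
  ih = hookFormula μ parts
  p≡′ : p ≡ r + (h + sum μ)
  p≡′ = trans p≡ (ℕsolve 3 (λ h r s → h ⊞ (r ⊞ s) ⊜ r ⊞ (h ⊞ s)) refl h r (sum μ))

betaSet-ones : ∀ K → Punctured (suc K) 0 (betaSet (replicate K 1))
betaSet-ones zero = record
  { unique = [] ; bounded = λ () ; hole = λ () ; complete = λ { (s≤s z≤n) 0≢0 → ⊥-elim (0≢0 refl) } ; size = refl }
betaSet-ones (suc K) rewrite length-replicate K {1} = record
  { unique   = All.tabulate (λ z∈ → ℕₚ.<⇒≢ (bounded z∈) ∘ sym) ∷ unique
  ; bounded  = λ { (here refl) → ℕₚ.≤-refl ; (there z∈) → ℕₚ.m<n⇒m<1+n (bounded z∈) }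
  ; hole     = λ { (here ()) ; (there 0∈) → hole 0∈ }
  ; complete = complete′
  ; size     = cong suc size
  }
  where
  open Punctured (betaSet-ones K)
  complete′ : ∀ {z} → z < suc (suc K) → z ≢ 0 → z ∈ suc K ∷ betaSet (replicate K 1)
  complete′ {z} z<2+K z≢0 with z ℕₚ.≟ suc K
  ... | yes z≡1+K = here z≡1+K
  ... | no z≢1+K  = there (complete (ℕₚ.≤∧≢⇒< (ℕₚ.≤-pred z<2+K) z≢1+K) z≢0)

hookCharacter : ∀ ν N i → All (1 ≤_) ν → sum ν ≡ N → i < N →
  χ (suc i ∷ replicate (N ∸ suc i) 1) ν ≡ alternate (hookSeries ν) (N ∸ suc i)
hookCharacter ν N i parts ν⊢N i<N = hookFormula ν parts (betaSet-ones K) refl top≡ K<top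
  where
  K = N ∸ suc i
  length≡ : suc i + length (replicate K 1) ≡ suc i + K
  length≡ = cong (λ k → suc i + k) (length-replicate K)
  top≡ : suc i + length (replicate K 1) ≡ 0 + sum ν
  top≡ = trans length≡ (trans (ℕₚ.m+[n∸m]≡n i<N) (sym ν⊢N))
  K<top : suc K ≤ suc i + length (replicate K 1)
  K<top = subst (suc K ≤_) (sym length≡) (s≤s (ℕₚ.m≤n+m K i))

sum-pad : ∀ μ n → sum μ ≤ n → sum (pad μ n) ≡ n
sum-pad μ n μ≤n = trans (sum-++ μ _) (trans (cong (λ k → sum μ + k) (sum-ones (n ∸ sum μ))) (ℕₚ.m+[n∸m]≡n μ≤n))
  where
  sum-ones : ∀ m → sum (replicate m 1) ≡ m
  sum-ones zero    = refl
  sum-ones (suc m) = cong suc (sum-ones m)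

pad-positive : ∀ μ n → All (1 ≤_) μ → All (1 ≤_) (pad μ n)
pad-positive μ n μ≥1 = Allₚ.++⁺ μ≥1 (Allₚ.replicate⁺ (n ∸ sum μ) ℕₚ.≤-refl)

A≡∑twoRowSeries : ∀ μ n → All (1 ≤_) μ → sum μ ≤ n → A μ n ≡ ∑< (suc (n / 2)) (sq ∘ twoRowSeries (pad μ n))
A≡∑twoRowSeries μ n μ≥1 μ≤n =
  trans (sumℤ-map-applyUpTo (λ j → sq (χ ((n ∸ j) ∷ j ∷ []) (pad μ n))) id (suc (n / 2)))
        (∑<-cong (suc (n / 2)) (λ j j≤n/2 → cong sq
          (twoRowCharacter (pad μ n) n j (pad-positive μ n μ≥1) (sum-pad μ n μ≤n) (j+j≤n (ℕₚ.≤-pred j≤n/2)))))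
  where
  j+j≤n : ∀ {j} → j ≤ n / 2 → j + j ≤ n
  j+j≤n {j} j≤n/2 = ℕₚ.≤-trans (ℕₚ.≤-reflexive (ℕsolve 1 (λ j → j ⊞ j ⊜ j ⊠ ℕcon 2) refl j))
                                (ℕₚ.≤-trans (ℕₚ.*-monoˡ-≤ 2 j≤n/2) (DivMod.m/n*n≤m n 2))

B≡∑hookSeries : ∀ μ N → All (1 ≤_) μ → sum μ ≤ N →
  B μ N ≡ ∑< N (λ i → sq (alternate (hookSeries (pad μ N)) (N ∸ suc i)))
B≡∑hookSeries μ N μ≥1 μ≤N =
  trans (sumℤ-map-applyUpTo (λ i → sq (χ (suc i ∷ replicate (N ∸ suc i) 1) (pad μ N))) id N)
        (∑<-cong N (λ i i<N → cong sq
          (hookCharacter (pad μ N) N i (pad-positive μ N μ≥1) (sum-pad μ N μ≤N) i<N)))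

sum-powers2 : ∀ t → sum (powers2 (suc t)) + 2 ≡ 2 ^ suc t
sum-powers2 zero    = refl
sum-powers2 (suc t) = begin
  sum (powers2 (suc (suc t))) + 2              ≡⟨ cong (λ μ → sum μ + 2) (applyUpTo-∷ʳ _ t) ⟨
  sum (powers2 (suc t) ++ p ∷ []) + 2          ≡⟨ cong (_+ 2) (sum-++ (powers2 (suc t)) (p ∷ [])) ⟩
  sum (powers2 (suc t)) + (p + 0) + 2          ≡⟨ ℕₚ.+-assoc (sum (powers2 (suc t))) (p + 0) 2 ⟩
  sum (powers2 (suc t)) + ((p + 0) + 2)        ≡⟨ cong (λ k → sum (powers2 (suc t)) + k) (ℕₚ.+-comm (p + 0) 2) ⟩
  sum (powers2 (suc t)) + (2 + (p + 0))        ≡⟨ ℕₚ.+-assoc (sum (powers2 (suc t))) 2 (p + 0) ⟨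
  sum (powers2 (suc t)) + 2 + (p + 0)          ≡⟨ cong (_+ (p + 0)) (sum-powers2 t) ⟩
  2 ^ suc (suc t)                               ∎
  where
  open ≡-Reasoning
  p = 2 ^ suc t

sum-μ₀′ : ∀ a t → sum (μ₀' a (suc t)) ≡ sum (μ₀ a (suc t)) + 2
sum-μ₀′ a t = begin
  sum (μ₀' a (suc t))                      ≡⟨ sum-↭ (sortDesc-↭ (a ++ 2 ^ suc t ∷ [])) ⟩
  sum (a ++ 2 ^ suc t ∷ [])                ≡⟨ sum-++ a _ ⟩
  sum a + (2 ^ suc t + 0)                  ≡⟨ cong (λ k → sum a + k) (trans (ℕₚ.+-identityʳ _) (sym (sum-powers2 t))) ⟩
  sum a + (sum (powers2 (suc t)) + 2)      ≡⟨ ℕₚ.+-assoc (sum a) _ 2 ⟨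
  sum a + sum (powers2 (suc t)) + 2        ≡⟨ cong (_+ 2) (sum-++ a _) ⟨
  sum (a ++ powers2 (suc t)) + 2           ≡⟨ cong (_+ 2) (sum-↭ (sortDesc-↭ (a ++ powers2 (suc t)))) ⟨
  sum (μ₀ a (suc t)) + 2                   ∎
  where open ≡-Reasoning

sortDesc-positive : ∀ μ ν → All (1 ≤_) μ → All (1 ≤_) ν → All (1 ≤_) (sortDesc (μ ++ ν))
sortDesc-positive μ ν μ≥1 ν≥1 = ↭ₚ.All-resp-↭ (↭.↭-sym (sortDesc-↭ (μ ++ ν))) (Allₚ.++⁺ μ≥1 ν≥1)

2^-positive : ∀ t → 1 ≤ 2 ^ t
2^-positive zero    = ℕₚ.≤-refl
2^-positive (suc t) = ℕₚ.≤-trans (2^-positive t) (ℕₚ.m≤m+n (2 ^ t) _)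

alternate-hookSeries-pad : ∀ a t n → All (λ x → x % 2 ≡ 1) a →
  alternate (hookSeries (pad (μ₀' a (suc t)) (n + 2))) ≗ twoRowSeries (pad (μ₀ a (suc t)) n)
alternate-hookSeries-pad a t n a-odd =
  subst (λ m → alternate (hookSeries (μ₀' a (suc t) ++ replicate m 1)) ≗ twoRowSeries (pad (μ₀ a (suc t)) n))
  (sym same-padding) (alternate-hookSeries a t (n ∸ sum (μ₀ a (suc t))) a-odd)
  where
  same-padding : n + 2 ∸ sum (μ₀' a (suc t)) ≡ n ∸ sum (μ₀ a (suc t))
  same-padding = trans (cong (n + 2 ∸_) (sum-μ₀′ a t)) (cong₂ _∸_ (ℕₚ.+-comm n 2) (ℕₚ.+-comm (sum (μ₀ a (suc t))) 2))

mainTheorem1 : (a : List ℕ) → (t : ℕ) → t ≥ 1 →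
    Linked _≥_ a → All (λ x → x ≥ 3) a → All (λ x → x % 2 ≡ 1) a →
    (n : ℕ) → n ≥ ∣ μ₀ a t ∣ₚ →
    (+ 2) ℤ.* A (μ₀ a t) n ≡ B (μ₀' a t) (n + 2)
-- The order of a (Linked) is irrelevant as μ₀ and μ₀' are sorted, and a ≥ 3 is only used as positivity.
mainTheorem1 a (suc t) _ _ a≥3 a-odd n μ≤n = begin
  + 2 ℤ.* A μ n                        ≡⟨ cong (+ 2 ℤ.*_) (A≡∑twoRowSeries μ n μ≥1 μ≤n) ⟩
  + 2 ℤ.* ∑< (suc (n / 2)) (sq ∘ F)    ≡⟨ ∑<-squares-antipalindrome n F F-antisymmetric ⟩
  ∑< (suc (suc n)) (sq ∘ F)            ≡⟨ cong (λ K → ∑< K (sq ∘ F)) (ℕₚ.+-comm 2 n) ⟩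
  ∑< (n + 2) (sq ∘ F)                  ≡⟨ ∑<-reverse (n + 2) _ _ reflected ⟨
  ∑< (n + 2) (λ i → sq (alternate (hookSeries (pad μ′ (n + 2))) (n + 2 ∸ suc i)))
                                       ≡⟨ B≡∑hookSeries μ′ (n + 2) μ′≥1 μ′≤n+2 ⟨
  B μ′ (n + 2)                         ∎
  where
  open ≡-Reasoning
  μ = μ₀ a (suc t)
  μ′ = μ₀' a (suc t)
  F = twoRowSeries (pad μ n)
  a≥1 : All (1 ≤_) a
  a≥1 = All.map (ℕₚ.≤-trans (s≤s z≤n)) a≥3
  μ≥1 : All (1 ≤_) μ
  μ≥1 = sortDesc-positive a (powers2 (suc t)) a≥1 (Allₚ.applyUpTo⁺₁ _ t (λ {i} _ → 2^-positive (suc i)))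
  μ′≥1 : All (1 ≤_) μ′
  μ′≥1 = sortDesc-positive a (2 ^ suc t ∷ []) a≥1 (2^-positive (suc t) ∷ [])
  μ′≤n+2 : sum μ′ ≤ n + 2
  μ′≤n+2 = subst (_≤ n + 2) (sym (sum-μ₀′ a t)) (ℕₚ.+-monoˡ-≤ 2 μ≤n)
  F-antisymmetric : ∀ i j → i + j ≡ suc n → F i ≡ ℤ.- F j
  F-antisymmetric i j e = twoRowSeries-antisymmetric (pad μ n) i j (trans e (cong suc (sym (sum-pad μ n μ≤n))))
  reflected : ∀ i j → suc (i + j) ≡ n + 2 → sq (alternate (hookSeries (pad μ′ (n + 2))) (n + 2 ∸ suc i)) ≡ sq (F j)
  reflected i j e = cong sq (trans
    (cong (alternate (hookSeries (pad μ′ (n + 2)))) (trans (cong (_∸ suc i) (sym e)) (ℕₚ.m+n∸m≡n (suc i) j)))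
    (alternate-hookSeries-pad a t n a-odd j))
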